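{- Let $t\ge2$ and let $\mu\subseteq\lambda$ be partitions such that $\lambda/\mu$ is tileable by $t$-ribbons. Then \[ \mathrm{sgn}_t(\lambda/\mu)\,\mathrm{sgn}_t(\lambda'/\mu')=(-1)^{(t-1)(|\lambda^{(0)}|+\cdots+|\lambda^{(t-1)}|-|\mu^{(0)}|-\cdots-|\mu^{(t-1)}|)}. \]
   Context: $\nu'$ denotes the conjugate partition. A ribbon is a connected skew shape with no $2\times2$ square; a $t$-ribbon has $t$ boxes; $\mathrm{ht}(R)$ is one less than the number of rows of $R$. $\lambda/\mu$ is tileable by $t$-ribbons if there is a chain $\mu=\nu^{(0)}\subseteq\cdots\subseteq\nu^{(k)}=\lambda$ with each $\nu^{(i)}/\nu^{(i-1)}$ a $t$-ribbon, and $\mathrm{sgn}_t(\lambda/\mu)=(-1)^{\sum_i\mathrm{ht}(\nu^{(i)}/\nu^{(i-1)})}$ (independent of the chain). (If $\lambda/\mu$ is $t$-tileable then so is $\lambda'/\mu'$.) $t$-quotient: for $N\ge l(\lambda)$ a multiple of $t$, let $\beta(\lambda;N)=\{\lambda_i+N-i\}$, $m_r$ the number of its elements $\equiv r\pmod t$, written $\xi^{(r)}_kt+r$ with $\xi^{(r)}_1>\cdots>\xi^{(r)}_{m_r}\ge0$; then $\lambda^{(r)}_k=\xi^{(r)}_k-m_r+k$ and $(\lambda^{(0)},\dots,\lambda^{(t-1)})$ is the $t$-quotient. $|\nu|$ is the size of $\nu$. -}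

module Defs where

open import Data.Nat using (ℕ; zero; suc; _+_; _*_; _∸_; _≤_; _<_; _≟_; _<?_)
open import Data.Nat.DivMod using (_%_; _/_)
open import Data.Nat.ListAction using (sum)
open import Data.List using (List; []; _∷_; map; length; filter; upTo; foldr)
open import Data.List.Relation.Unary.All using (All)
open import Data.List.Relation.Unary.Linked using (Linked)
open import Data.Product using (_×_; _,_; ∃)
open import Data.Integer as ℤ using (ℤ)
open import Relation.Nullary using (¬_)
open import Relation.Binary.PropositionalEquality using (_≡_)

Partition : Set
Partition = List ℕ

IsPartition : Partition → Set
IsPartition λ′ = Linked (λ a b → b ≤ a) λ′ × All (λ a → 0 < a) λ′

-- i-th part (0-based), 0 beyond the length
part : Partition → ℕ → ℕ
part []       _       = 0
part (x ∷ _)  zero    = x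
part (_ ∷ xs) (suc i) = part xs i

size : Partition → ℕ
size = sum

_⊆ₚ_ : Partition → Partition → Set
μ ⊆ₚ λ′ = ∀ i → part μ i ≤ part λ′ i

conj : Partition → Partition
conj λ′ = map (λ j → length (filter (j <?_) λ′)) (upTo (part λ′ 0))

-- Skew shapes, cells (row i, column j), 0-based.

Cell : Set
Cell = ℕ × ℕ

InSkew : Partition → Partition → Cell → Set
InSkew λ′ μ (i , j) = part μ i ≤ j × j < part λ′ i

data Adj : Cell → Cell → Set where
  right : ∀ i j → Adj (i , j) (i , suc j)
  left  : ∀ i j → Adj (i , suc j) (i , j)
  down  : ∀ i j → Adj (i , j) (suc i , j)
  up    : ∀ i j → Adj (suc i , j) (i , j)

data Path (λ′ μ : Partition) : Cell → Cell → Set where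
  here : ∀ {a} → InSkew λ′ μ a → Path λ′ μ a a
  step : ∀ {a b c} → InSkew λ′ μ a → Adj a b → Path λ′ μ b c → Path λ′ μ a c

Connected : Partition → Partition → Set
Connected λ′ μ = ∀ a b → InSkew λ′ μ a → InSkew λ′ μ b → Path λ′ μ a b

No2x2 : Partition → Partition → Set
No2x2 λ′ μ = ∀ i j → ¬ (InSkew λ′ μ (i , j) × InSkew λ′ μ (i , suc j)
                        × InSkew λ′ μ (suc i , j) × InSkew λ′ μ (suc i , suc j))

IsRibbon : ℕ → Partition → Partition → Set
IsRibbon t λ′ μ = IsPartition μ × IsPartition λ′ × μ ⊆ₚ λ′
                  × Connected λ′ μ × No2x2 λ′ μ × size λ′ ∸ size μ ≡ t

rows : Partition → Partition → ℕ
rows λ′ μ = length (filter (λ i → part μ i <? part λ′ i) (upTo (length λ′)))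

ht : Partition → Partition → ℕ
ht λ′ μ = rows λ′ μ ∸ 1

-- A t-ribbon tiling  μ = ν⁰ ⊆ ν¹ ⊆ ⋯ ⊆ νᵏ = λ, indexed by the total height
-- Σ ht(νⁱ/νⁱ⁻¹).
data Tiling (t : ℕ) (μ : Partition) : Partition → ℕ → Set where
  done : Tiling t μ μ 0
  add  : ∀ {ν κ h} → Tiling t μ ν h → IsRibbon t κ ν → Tiling t μ κ (h + ht κ ν)

Tileable : ℕ → Partition → Partition → Set
Tileable t λ′ μ = ∃ λ h → Tiling t μ λ′ h

negOnePow : ℕ → ℤ
negOnePow zero    = ℤ.+ 1
negOnePow (suc n) = ℤ.- negOnePow n

negOnePowℤ : ℤ → ℤ
negOnePowℤ z = negOnePow ℤ.∣ z ∣

-- t-quotient, with N = t · l(λ) (a multiple of t with N ≥ l(λ)).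

modt : ℕ → ℕ → ℕ
modt zero    x = x
modt (suc k) x = x % suc k

divt : ℕ → ℕ → ℕ
divt zero    x = 0
divt (suc k) x = x / suc k

beta : Partition → ℕ → List ℕ
beta λ′ N = map (λ i → part λ′ i + (N ∸ suc i)) (upTo N)

quotParts : List ℕ → List ℕ
quotParts ξ = go 1 ξ
  where
  m = length ξ
  go : ℕ → List ℕ → List ℕ
  go k []       = []
  go k (x ∷ xs) = (x + k ∸ m) ∷ go (suc k) xs

quotient : ℕ → Partition → ℕ → Partition
quotient t λ′ r =
  quotParts (map (divt t) (filter (λ b → modt t b ≟ r) (beta λ′ (t * length λ′))))

quotientSize : ℕ → Partition → ℕ
quotientSize t λ′ = sum (map (λ r → size (quotient t λ′ r)) (upTo t))

-- Read β(λ;N) on a t-abacus. Adding a t-ribbon with rows a,…,b to ν moves the bead of row b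
-- up by t into row a, past the b − a beads of rows a,…,b−1, none of which lies on its runner.
-- Hence the total size of the t-quotient grows by one, and the parity of the number of
-- increasing pairs in the residue sequence changes by ht = b − a; the transposed ribbon has
-- height t − 1 − ht. So for every tiling, sgn_t is the change of this parity between its two
-- ends, for λ/μ and λ′/μ′ alike, and following a single tiling of λ/μ with j ribbons the two
-- changes add up to (t − 1) j, where j is the difference of the quotient sizes.

module Submission where

open import Defs
open import Data.Nat using (ℕ; zero; suc; _+_; _*_; _∸_; _≤_; _<_; z≤n; s≤s; z<s; s≤s⁻¹; _≟_; _<?_; _≤?_; parity)
open import Data.Nat.Properties
open import Data.Nat.DivMod
open import Data.Nat.ListAction using (sum)
open import Data.Nat.ListAction.Properties using (sum-++)
open import Data.Nat.Tactic.RingSolver using (solve-∀)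
open import Algebra.Properties.CommutativeSemigroup +-commutativeSemigroup using () renaming (interchange to +-interchange)
open import Data.Parity.Base as ℙ using (Parity; 0ℙ; 1ℙ; _⁻¹)
import Data.Parity.Properties as ℙ
open import Data.List using (List; []; _∷_; _++_; [_]; map; length; filter; upTo; applyUpTo; downFrom; drop)
open import Data.List.Properties
  using ( map-applyUpTo; map-upTo; length-applyUpTo; length-map; length-++; map-++; ++-assoc; applyUpTo-∷ʳ
        ; filter-++; filter-accept; filter-reject; filter-all; filter-none )
open import Data.List.Relation.Binary.Permutation.Propositional using (↭-swap; ↭-refl)
open import Data.List.Relation.Binary.Permutation.Propositional.Properties using (↭-length; filter-↭; ++⁺ˡ)
open import Data.List.Relation.Unary.All as All using (All; []; _∷_)
open import Data.List.Relation.Unary.All.Properties using () renaming (map⁺ to All-map⁺)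
open import Data.List.Relation.Unary.Linked using (Linked; []; [-]; _∷_)
open import Data.Product using (_×_; _,_; ∃; proj₁; proj₂)
open import Data.Sum using (inj₁; inj₂)
open import Data.Empty using (⊥-elim)
open import Data.Integer as ℤ using (ℤ)
import Data.Integer.Properties as ℤ
open import Function using (_∘_; id; _⇔_; mk⇔; Equivalence)
open import Function.Construct.Composition using (_⇔-∘_)
open import Function.Construct.Symmetry using (⇔-sym)
open import Relation.Nullary using (¬_; yes; no)
open import Relation.Binary.Definitions using (tri<; tri≈; tri>)
open import Relation.Unary using (Decidable)
open import Relation.Binary.PropositionalEquality hiding ([_])

open ≡-Reasoning

negOnePow-+ : ∀ m n → negOnePow (m + n) ≡ negOnePow m ℤ.* negOnePow n
negOnePow-+ zero    n = sym (ℤ.*-identityˡ (negOnePow n))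
negOnePow-+ (suc m) n = trans (cong ℤ.-_ (negOnePow-+ m n)) (ℤ.neg-distribˡ-* (negOnePow m) (negOnePow n))

private
  signOf : Parity → ℤ
  signOf 0ℙ = ℤ.+ 1
  signOf 1ℙ = ℤ.- (ℤ.+ 1)

  signOf-⁻¹ : ∀ p → signOf (p ⁻¹) ≡ ℤ.- signOf p
  signOf-⁻¹ 0ℙ = refl
  signOf-⁻¹ 1ℙ = refl

  negOnePow≡signOf∘parity : ∀ n → negOnePow n ≡ signOf (parity n)
  negOnePow≡signOf∘parity zero    = refl
  negOnePow≡signOf∘parity (suc n) = begin
    ℤ.- negOnePow n                ≡⟨ cong ℤ.-_ (negOnePow≡signOf∘parity n) ⟩
    ℤ.- signOf (parity n)          ≡⟨ signOf-⁻¹ (parity n) ⟨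
    signOf (parity n ⁻¹)           ≡⟨ cong signOf (ℙ.⁻¹-selfInverse (ℙ.suc-homo-⁻¹ n)) ⟩
    signOf (parity (suc n))        ∎

negOnePow-parity : ∀ {m n} → parity m ≡ parity n → negOnePow m ≡ negOnePow n
negOnePow-parity {m} {n} eq =
  trans (negOnePow≡signOf∘parity m) (trans (cong signOf eq) (sym (negOnePow≡signOf∘parity n)))

+[m+n]-+m≡+n : ∀ m n → ℤ.+ (m + n) ℤ.- ℤ.+ m ≡ ℤ.+ n
+[m+n]-+m≡+n m n = trans (ℤ.m-n≡m⊖n (m + n) m) (trans (ℤ.⊖-≥ (m≤m+n m n)) (cong ℤ.+_ (m+n∸m≡n m n)))

parity-+-cong : ∀ {a b c d} → parity a ≡ parity b → parity c ≡ parity d → parity (a + c) ≡ parity (b + d)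
parity-+-cong {a} {b} {c} {d} a≡b c≡d =
  trans (ℙ.+-homo-+ a c) (trans (cong₂ ℙ._+_ a≡b c≡d) (sym (ℙ.+-homo-+ b d)))

parity-cancelˡ : ∀ a {b c} → parity (a + b) ≡ parity (a + c) → parity b ≡ parity c
parity-cancelˡ a {b} {c} eq = ℙ.+-cancelˡ-≡ (parity a) (parity b) (parity c) (trans (sym (ℙ.+-homo-+ a b)) (trans eq (ℙ.+-homo-+ a c)))

≤-from-< : ∀ {m n} → (∀ i → i < m → i < n) → m ≤ n
≤-from-< {zero}  h = z≤n
≤-from-< {suc m} h = h m ≤-refl

module _ {P : ℕ → Set} (P? : Decidable P) where

  least : ∀ {i} → P i → ∃ λ a → P a × (∀ k → k < a → ¬ P k)
  least {i} Pi = go i (i , ≤-refl , Pi)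
    where
    go : ∀ n → (∃ λ i → i ≤ n × P i) → ∃ λ a → P a × (∀ k → k < a → ¬ P k)
    go zero (zero , _ , P0) = 0 , P0 , λ _ ()
    go (suc n) (i , i≤n , Pi) with anyUpTo? P? (suc n)
    ... | yes (m , m<n , Pm) = go n (m , s≤s⁻¹ m<n , Pm)
    ... | no none with m≤n⇒m<n∨m≡n i≤n
    ...   | inj₁ i<n  = ⊥-elim (none (i , i<n , Pi))
    ...   | inj₂ refl = i , Pi , λ k k<i Pk → none (k , k<i , Pk)

  greatest : ∀ {n i} → P i → (∀ k → P k → k < n) → ∃ λ b → P b × (∀ k → P k → k ≤ b)
  greatest {zero}  Pi bound = ⊥-elim (n≮0 (bound _ Pi))
  greatest {suc n} Pi bound with P? n
  ... | yes Pn = n , Pn , λ k Pk → s≤s⁻¹ (bound k Pk)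
  ... | no ¬Pn = greatest Pi (λ k Pk → ≤∧≢⇒< (s≤s⁻¹ (bound k Pk)) λ { refl → ¬Pn Pk })

interval-unique : ∀ {lo hi lo′ hi′} → (∀ {i} → (lo ≤ i × i < hi) ⇔ (lo′ ≤ i × i < hi′)) → lo < hi →
  lo ≡ lo′ × hi ≡ hi′
interval-unique {hi′ = zero} same lo<hi = ⊥-elim (n≮0 (proj₂ (Equivalence.to same (≤-refl , lo<hi))))
interval-unique {lo} {suc h} {lo′} {suc h′} same lo<hi = lo≡lo′ , cong suc (≤-antisym h≤h′ h′≤h)
  where
  to : ∀ {i} → lo ≤ i × i < suc h → lo′ ≤ i × i < suc h′
  to = Equivalence.to same
  from : ∀ {i} → lo′ ≤ i × i < suc h′ → lo ≤ i × i < suc h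
  from = Equivalence.from same
  lo∈′ : lo′ ≤ lo × lo < suc h′
  lo∈′ = to (≤-refl , lo<hi)
  lo≡lo′ : lo ≡ lo′
  lo≡lo′ = ≤-antisym (proj₁ (from (≤-refl , ≤-<-trans (proj₁ lo∈′) (proj₂ lo∈′)))) (proj₁ lo∈′)
  h≤h′ : h ≤ h′
  h≤h′ = s≤s⁻¹ (proj₂ (to {h} (s≤s⁻¹ lo<hi , ≤-refl)))
  h′≤h : h′ ≤ h
  h′≤h = s≤s⁻¹ (proj₂ (from {h′} (≤-trans (≤-reflexive (sym lo≡lo′)) (≤-trans (s≤s⁻¹ lo<hi) h≤h′) , ≤-refl)))

part-applyUpTo : ∀ (f : ℕ → ℕ) {n i} → i < n → part (applyUpTo f n) i ≡ f i
part-applyUpTo f {suc n} {zero}  _         = refl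
part-applyUpTo f {suc n} {suc i} (s≤s i<n) = part-applyUpTo (f ∘ suc) i<n

part-applyUpTo-≥ : ∀ (f : ℕ → ℕ) {n i} → n ≤ i → part (applyUpTo f n) i ≡ 0
part-applyUpTo-≥ f {zero}           _         = refl
part-applyUpTo-≥ f {suc n} {suc i} (s≤s n≤i) = part-applyUpTo-≥ (f ∘ suc) n≤i

applyUpTo-+ : ∀ {A : Set} (f : ℕ → A) m n → applyUpTo f (m + n) ≡ applyUpTo f m ++ applyUpTo (λ i → f (m + i)) n
applyUpTo-+ f zero    n = refl
applyUpTo-+ f (suc m) n = cong (f 0 ∷_) (applyUpTo-+ (f ∘ suc) m n)

applyUpTo-cong : ∀ {A : Set} {f g : ℕ → A} n → (∀ i → i < n → f i ≡ g i) → applyUpTo f n ≡ applyUpTo g n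
applyUpTo-cong zero    eq = refl
applyUpTo-cong (suc n) eq = cong₂ _∷_ (eq 0 z<s) (applyUpTo-cong n (λ i i<n → eq (suc i) (s≤s i<n)))

applyUpTo-around : ∀ {A : Set} (f : ℕ → A) a d e →
  applyUpTo f (a + suc (d + e)) ≡ applyUpTo f a ++ applyUpTo (λ i → f (a + i)) d ++ f (a + d) ∷ applyUpTo (λ i → f (a + suc (d + i))) e
applyUpTo-around f a d e = begin
  applyUpTo f (a + suc (d + e))                  ≡⟨ cong (λ k → applyUpTo f (a + k)) (+-suc d e) ⟨
  applyUpTo f (a + (d + suc e))                  ≡⟨ applyUpTo-+ f a (d + suc e) ⟩
  applyUpTo f a ++ applyUpTo (λ i → f (a + i)) (d + suc e)
    ≡⟨ cong (applyUpTo f a ++_) (applyUpTo-+ (λ i → f (a + i)) d (suc e)) ⟩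
  applyUpTo f a ++ applyUpTo (λ i → f (a + i)) d ++ f (a + (d + 0)) ∷ applyUpTo (λ i → f (a + (d + suc i))) e
    ≡⟨ cong (λ l → applyUpTo f a ++ applyUpTo (λ i → f (a + i)) d ++ l)
            (cong₂ _∷_ (cong (λ k → f (a + k)) (+-identityʳ d)) (applyUpTo-cong e (λ i _ → cong (λ k → f (a + k)) (+-suc d i)))) ⟩
  applyUpTo f a ++ applyUpTo (λ i → f (a + i)) d ++ f (a + d) ∷ applyUpTo (λ i → f (a + suc (d + i))) e ∎

All-applyUpTo : ∀ {P : ℕ → Set} (f : ℕ → ℕ) n → (∀ i → i < n → P (f i)) → All P (applyUpTo f n)
All-applyUpTo f zero    h = []
All-applyUpTo f (suc n) h = h 0 z<s ∷ All-applyUpTo (f ∘ suc) n (λ i i<n → h (suc i) (s≤s i<n))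

applyUpTo-Linked : ∀ {R : ℕ → ℕ → Set} (f : ℕ → ℕ) n → (∀ i → suc i < n → R (f i) (f (suc i))) →
  Linked R (applyUpTo f n)
applyUpTo-Linked f zero          h = []
applyUpTo-Linked f (suc zero)    h = [-]
applyUpTo-Linked f (suc (suc n)) h = h 0 (s≤s z<s) ∷ applyUpTo-Linked (f ∘ suc) (suc n) (λ i i<n → h (suc i) (s≤s i<n))

StrictlyDecreasing : List ℕ → Set
StrictlyDecreasing = Linked (λ u v → v < u)

length-filter-interval : ∀ {P : ℕ → Set} (P? : Decidable P) a d e → (∀ {i} → P i ⇔ (a ≤ i × i ≤ a + d)) →
  length (filter P? (upTo (a + suc (d + e)))) ≡ suc d
length-filter-interval {P} P? a d e P⇔ = begin
  length (filter P? (upTo (a + suc (d + e))))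
    ≡⟨ cong (length ∘ filter P?) (trans (applyUpTo-+ id a (suc d + e)) (cong (upTo a ++_) (applyUpTo-+ (a +_) (suc d) e))) ⟩
  length (filter P? (upTo a ++ applyUpTo (a +_) (suc d) ++ applyUpTo (λ i → a + (suc d + i)) e))
    ≡⟨ cong length (filter-++ P? (upTo a) _) ⟩
  length (filter P? (upTo a) ++ filter P? (applyUpTo (a +_) (suc d) ++ applyUpTo (λ i → a + (suc d + i)) e))
    ≡⟨ cong length (cong₂ _++_ (filter-none P? below) (filter-++ P? (applyUpTo (a +_) (suc d)) _)) ⟩
  length (filter P? (applyUpTo (a +_) (suc d)) ++ filter P? (applyUpTo (λ i → a + (suc d + i)) e))
    ≡⟨ cong length (cong₂ _++_ (filter-all P? inside) (filter-none P? above)) ⟩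
  length (applyUpTo (a +_) (suc d) ++ [])
    ≡⟨ trans (length-++ (applyUpTo (a +_) (suc d))) (trans (+-identityʳ _) (length-applyUpTo (a +_) (suc d))) ⟩
  suc d ∎
  where
  below : All (λ i → ¬ P i) (upTo a)
  below = All-applyUpTo id a (λ i i<a a≤i → <⇒≱ i<a (proj₁ (Equivalence.to P⇔ a≤i)))
  inside : All P (applyUpTo (a +_) (suc d))
  inside = All-applyUpTo (a +_) (suc d) (λ i i≤d → Equivalence.from P⇔ (m≤m+n a i , +-monoʳ-≤ a (s≤s⁻¹ i≤d)))
  above : All (λ i → ¬ P i) (applyUpTo (λ i → a + (suc d + i)) e)
  above = All-applyUpTo (λ i → a + (suc d + i)) e (λ i _ Pi →
    <⇒≱ (+-monoʳ-< a (s≤s (m≤m+n d i))) (proj₂ (Equivalence.to P⇔ Pi)))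

sum-applyUpTo-suc : ∀ (f : ℕ → ℕ) n → sum (applyUpTo f (suc n)) ≡ sum (applyUpTo f n) + f n
sum-applyUpTo-suc f n = trans (cong sum (sym (applyUpTo-∷ʳ f n)))
  (trans (sum-++ (applyUpTo f n) [ f n ]) (cong (sum (applyUpTo f n) +_) (+-identityʳ (f n))))

sum-applyUpTo-+ : ∀ (f : ℕ → ℕ) m n → sum (applyUpTo f (m + n)) ≡ sum (applyUpTo f m) + sum (applyUpTo (λ i → f (m + i)) n)
sum-applyUpTo-+ f m n = trans (cong sum (applyUpTo-+ f m n)) (sum-++ (applyUpTo f m) _)

sum-applyUpTo-zero : ∀ {f : ℕ → ℕ} n → (∀ i → i < n → f i ≡ 0) → sum (applyUpTo f n) ≡ 0
sum-applyUpTo-zero zero    _  = refl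
sum-applyUpTo-zero (suc n) f0 = cong₂ _+_ (f0 0 z<s) (sum-applyUpTo-zero n (λ i i<n → f0 (suc i) (s≤s i<n)))

sum-applyUpTo-bump : ∀ {f g : ℕ → ℕ} n {s} → s < n → (∀ r → r ≢ s → f r ≡ g r) → f s ≡ suc (g s) →
  sum (applyUpTo f n) ≡ suc (sum (applyUpTo g n))
sum-applyUpTo-bump {f} {g} (suc n) {zero} _ f≡g f≡1+g =
  cong₂ _+_ f≡1+g (cong sum (applyUpTo-cong n (λ r _ → f≡g (suc r) λ ())))
sum-applyUpTo-bump {f} {g} (suc n) {suc s} (s≤s s<n) f≡g f≡1+g =
  trans (cong₂ _+_ (f≡g 0 λ ()) (sum-applyUpTo-bump n s<n (λ r r≢s → f≡g (suc r) (r≢s ∘ suc-injective)) f≡1+g))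
        (+-suc (g 0) _)

sum-applyUpTo-∸ : ∀ {f g : ℕ → ℕ} n → (∀ i → i < n → f i ≤ g i) →
  sum (applyUpTo f n) + sum (applyUpTo (λ i → g i ∸ f i) n) ≡ sum (applyUpTo g n)
sum-applyUpTo-∸ zero    _   = refl
sum-applyUpTo-∸ {f} {g} (suc n) f≤g = begin
  (f 0 + F) + ((g 0 ∸ f 0) + D) ≡⟨ +-interchange (f 0) F (g 0 ∸ f 0) D ⟩
  (f 0 + (g 0 ∸ f 0)) + (F + D) ≡⟨ cong₂ _+_ (m+[n∸m]≡n (f≤g 0 z<s)) (sum-applyUpTo-∸ n (λ i i<n → f≤g (suc i) (s≤s i<n))) ⟩
  g 0 + sum (applyUpTo (g ∘ suc) n) ∎
  where
  F D : ℕ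
  F = sum (applyUpTo (f ∘ suc) n)
  D = sum (applyUpTo (λ i → g (suc i) ∸ f (suc i)) n)

WeaklyDecreasing : List ℕ → Set
WeaklyDecreasing = Linked (λ a b → b ≤ a)

part-pos⇒<length : ∀ (L : Partition) {i} → 0 < part L i → i < length L
part-pos⇒<length (x ∷ L) {zero}  _   = z<s
part-pos⇒<length (x ∷ L) {suc i} pos = s≤s (part-pos⇒<length L pos)

part-≥length : ∀ (L : Partition) {i} → length L ≤ i → part L i ≡ 0
part-≥length []      _         = refl
part-≥length (x ∷ L) (s≤s l≤i) = part-≥length L l≤i

part-pos : ∀ {L : Partition} → All (0 <_) L → ∀ {i} → i < length L → 0 < part L i
part-pos (px ∷ _)  {zero}  _         = px
part-pos (_ ∷ pxs) {suc i} (s≤s i<l) = part-pos pxs i<l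

part-suc≤ : ∀ {L : Partition} → WeaklyDecreasing L → ∀ i → part L (suc i) ≤ part L i
part-suc≤ []          i       = z≤n
part-suc≤ [-]         i       = z≤n
part-suc≤ (y≤x ∷ _)   zero    = y≤x
part-suc≤ (_ ∷ dec)   (suc i) = part-suc≤ dec i

part-antitone : ∀ {L : Partition} → WeaklyDecreasing L → ∀ {i j} → i ≤ j → part L j ≤ part L i
part-antitone dec {j = zero}  z≤n = ≤-refl
part-antitone dec {j = suc j} i≤j with m≤n⇒m<n∨m≡n i≤j
... | inj₁ (s≤s i≤j′) = ≤-trans (part-suc≤ dec j) (part-antitone dec i≤j′)
... | inj₂ refl       = ≤-refl

length-mono : ∀ {κ ν : Partition} → IsPartition ν → ν ⊆ₚ κ → length ν ≤ length κ
length-mono {κ} {[]}     _        _   = z≤n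
length-mono {κ} {x ∷ xs} (_ , ps) ν⊆κ =
  part-pos⇒<length κ (<-≤-trans (part-pos ps (n<1+n (length xs))) (ν⊆κ (length xs)))

size≡sum-parts : ∀ (L : Partition) {n} → length L ≤ n → size L ≡ sum (applyUpTo (part L) n)
size≡sum-parts []      {n}     _         = sym (sum-applyUpTo-zero n (λ _ _ → refl))
size≡sum-parts (x ∷ L) {suc n} (s≤s l≤n) = cong (x +_) (size≡sum-parts L l≤n)

-- Conjugate partitions

countAbove : ℕ → Partition → ℕ
countAbove j L = length (filter (j <?_) L)

private
  weaklyDecreasing-tail : ∀ {x} {L : Partition} → WeaklyDecreasing (x ∷ L) → WeaklyDecreasing L
  weaklyDecreasing-tail [-]     = []
  weaklyDecreasing-tail (_ ∷ d) = d

<countAbove⇔<part : ∀ {L : Partition} → WeaklyDecreasing L → ∀ i j → i < countAbove j L ⇔ j < part L i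
<countAbove⇔<part {[]}     _   i j = mk⇔ (λ ()) (λ ())
<countAbove⇔<part {x ∷ xs} dec i j with j <? x
... | yes j<x rewrite filter-accept (j <?_) {x} {xs} j<x = mk⇔ (to i) (from i)
  where
  IH : ∀ i j → i < countAbove j xs ⇔ j < part xs i
  IH = <countAbove⇔<part (weaklyDecreasing-tail dec)
  to : ∀ i → i < suc (countAbove j xs) → j < part (x ∷ xs) i
  to zero    _         = j<x
  to (suc i) (s≤s i<c) = Equivalence.to (IH i j) i<c
  from : ∀ i → j < part (x ∷ xs) i → i < suc (countAbove j xs)
  from zero    _   = z<s
  from (suc i) j<p = s≤s (Equivalence.from (IH i j) j<p)
... | no j≮x rewrite filter-reject (j <?_) {x} {xs} j≮x = mk⇔ to from
  where
  to : i < countAbove j xs → j < part (x ∷ xs) i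
  to i<c = ⊥-elim (j≮x (<-≤-trans (Equivalence.to (<countAbove⇔<part (weaklyDecreasing-tail dec) 0 j) (≤-<-trans z≤n i<c))
                                   (part-suc≤ dec 0)))
  from : j < part (x ∷ xs) i → i < countAbove j xs
  from j<p = ⊥-elim (j≮x (<-≤-trans j<p (part-antitone dec {j = i} z≤n)))

part-conj : ∀ (L : Partition) {j} → j < part L 0 → part (conj L) j ≡ countAbove j L
part-conj L {j} j<L₀ = trans (cong (λ l → part l j) (map-applyUpTo id _ (part L 0))) (part-applyUpTo _ j<L₀)

part-conj-≥ : ∀ (L : Partition) {j} → part L 0 ≤ j → part (conj L) j ≡ 0
part-conj-≥ L {j} L₀≤j = trans (cong (λ l → part l j) (map-applyUpTo id _ (part L 0))) (part-applyUpTo-≥ _ L₀≤j)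

<part-conj⇔<part : ∀ {L : Partition} → WeaklyDecreasing L → ∀ i j → i < part (conj L) j ⇔ j < part L i
<part-conj⇔<part {L} dec i j with j <? part L 0
... | yes j<L₀ rewrite part-conj L j<L₀ = <countAbove⇔<part dec i j
... | no j≮L₀ rewrite part-conj-≥ L (≮⇒≥ j≮L₀) =
  mk⇔ (λ ()) (λ j<Lᵢ → ⊥-elim (j≮L₀ (<-≤-trans j<Lᵢ (part-antitone dec {j = i} z≤n))))

length-conj : ∀ (L : Partition) → length (conj L) ≡ part L 0
length-conj L = trans (length-map _ (upTo (part L 0))) (length-applyUpTo id (part L 0))

private
  conj≡applyUpTo : ∀ (L : Partition) → conj L ≡ applyUpTo (λ j → countAbove j L) (part L 0)
  conj≡applyUpTo L = map-applyUpTo id _ (part L 0)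

conj-isPartition : ∀ {L : Partition} → IsPartition L → IsPartition (conj L)
conj-isPartition {L} (dec , _) rewrite conj≡applyUpTo L =
    applyUpTo-Linked _ (part L 0) (λ j _ → ≤-from-< (λ i i<c →
      Equivalence.from (spec i j) (<-trans (n<1+n j) (Equivalence.to (spec i (suc j)) i<c))))
  , All-applyUpTo _ (part L 0) (λ j j<L₀ → Equivalence.from (spec 0 j) j<L₀)
  where
  spec : ∀ i j → i < countAbove j L ⇔ j < part L i
  spec = <countAbove⇔<part dec

conj-⊆ₚ : ∀ {κ ν : Partition} → IsPartition κ → IsPartition ν → ν ⊆ₚ κ → conj ν ⊆ₚ conj κ
conj-⊆ₚ (decκ , _) (decν , _) ν⊆κ j = ≤-from-< λ i i<ν′ →
  Equivalence.from (<part-conj⇔<part decκ i j) (<-≤-trans (Equivalence.to (<part-conj⇔<part decν i j) i<ν′) (ν⊆κ i))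

-- Border strips

record BorderStrip (κ ν : Partition) : Set where
  field
    outer     : IsPartition κ
    inner     : IsPartition ν
    ν⊆κ       : ν ⊆ₚ κ
    connected : Connected κ ν
    no2×2     : No2x2 κ ν

ribbon⇒borderStrip : ∀ {t κ ν} → IsRibbon t κ ν → BorderStrip κ ν
ribbon⇒borderStrip (pν , pκ , ν⊆κ , cn , no2 , _) = record
  { outer = pκ ; inner = pν ; ν⊆κ = ν⊆κ ; connected = cn ; no2×2 = no2 }

ribbon-⊆ₚ : ∀ {t κ ν} → IsRibbon t κ ν → ν ⊆ₚ κ
ribbon-⊆ₚ ribbon = BorderStrip.ν⊆κ (ribbon⇒borderStrip ribbon)

transpose : Cell → Cell
transpose (i , j) = (j , i)

module _ {κ ν : Partition} (decκ : WeaklyDecreasing κ) (decν : WeaklyDecreasing ν) where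

  InSkew-conj⇔ : ∀ {c} → InSkew κ ν c ⇔ InSkew (conj κ) (conj ν) (transpose c)
  InSkew-conj⇔ {i , j} = mk⇔
    (λ (ν≤j , j<κ) → ≮⇒≥ (λ i<ν′ → <⇒≱ (Equivalence.to (<part-conj⇔<part decν i j) i<ν′) ν≤j)
                    , Equivalence.from (<part-conj⇔<part decκ i j) j<κ)
    (λ (ν′≤i , i<κ′) → ≮⇒≥ (λ j<ν → <⇒≱ (Equivalence.from (<part-conj⇔<part decν i j) j<ν) ν′≤i)
                      , Equivalence.to (<part-conj⇔<part decκ i j) i<κ′)

  private
    toConj : ∀ {c} → InSkew κ ν c → InSkew (conj κ) (conj ν) (transpose c)
    toConj = Equivalence.to InSkew-conj⇔

    fromConj : ∀ {c} → InSkew (conj κ) (conj ν) (transpose c) → InSkew κ ν c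
    fromConj = Equivalence.from InSkew-conj⇔

    Adj-transpose : ∀ {a b} → Adj a b → Adj (transpose a) (transpose b)
    Adj-transpose (right i j) = down j i
    Adj-transpose (left i j)  = up j i
    Adj-transpose (down i j)  = right j i
    Adj-transpose (up i j)    = left j i

    Path-transpose : ∀ {a b} → Path κ ν a b → Path (conj κ) (conj ν) (transpose a) (transpose b)
    Path-transpose (here s)       = here (toConj s)
    Path-transpose (step s adj p) = step (toConj s) (Adj-transpose adj) (Path-transpose p)

  Connected-conj : Connected κ ν → Connected (conj κ) (conj ν)
  Connected-conj cn (i , j) (k , l) s s′ =
    Path-transpose (cn (j , i) (l , k) (fromConj {j , i} s) (fromConj {l , k} s′))

  No2x2-conj : No2x2 κ ν → No2x2 (conj κ) (conj ν)
  No2x2-conj no2 i j (s₁ , s₂ , s₃ , s₄) =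
    no2 j i (fromConj {j , i} s₁ , fromConj {j , suc i} s₃ , fromConj {suc j , i} s₂ , fromConj {suc j , suc i} s₄)

borderStrip-conj : ∀ {κ ν} → BorderStrip κ ν → BorderStrip (conj κ) (conj ν)
borderStrip-conj b = record
  { outer     = conj-isPartition outer
  ; inner     = conj-isPartition inner
  ; ν⊆κ       = conj-⊆ₚ outer inner ν⊆κ
  ; connected = Connected-conj (proj₁ outer) (proj₁ inner) connected
  ; no2×2     = No2x2-conj (proj₁ outer) (proj₁ inner) no2×2
  }
  where open BorderStrip b

module _ {κ ν : Partition} where

  Path-source : ∀ {c d} → Path κ ν c d → InSkew κ ν c
  Path-source (here s)     = s
  Path-source (step s _ _) = s

  Path-target : ∀ {c d} → Path κ ν c d → InSkew κ ν d
  Path-target (here s)     = s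
  Path-target (step _ _ p) = Path-target p

  Path-crossesRow : ∀ {c d} → Path κ ν c d → ∀ i → proj₁ c ≤ i → i < proj₁ d →
    ∃ λ j → InSkew κ ν (i , j) × InSkew κ ν (suc i , j)
  Path-crossesRow (here s) i c≤i i<d = ⊥-elim (<⇒≱ i<d c≤i)
  Path-crossesRow (step s (right _ _) p) i c≤i i<d = Path-crossesRow p i c≤i i<d
  Path-crossesRow (step s (left _ _) p)  i c≤i i<d = Path-crossesRow p i c≤i i<d
  Path-crossesRow (step s (down i′ j) p) i c≤i i<d with i ≟ i′
  ... | yes refl = j , s , Path-source p
  ... | no i≢i′  = Path-crossesRow p i (≤∧≢⇒< c≤i (i≢i′ ∘ sym)) i<d
  Path-crossesRow (step s (up i′ j) p)   i c≤i i<d = Path-crossesRow p i (≤-trans (n≤1+n i′) c≤i) i<d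

  Path-visitsRow : ∀ {c d} → Path κ ν c d → ∀ i → proj₁ c ≤ i → i ≤ proj₁ d → ∃ λ j → InSkew κ ν (i , j)
  Path-visitsRow p i c≤i i≤d with m≤n⇒m<n∨m≡n i≤d
  ... | inj₁ i<d  = let j , s , _ = Path-crossesRow p i c≤i i<d in j , s
  ... | inj₂ refl = _ , Path-target p

module _ {κ ν : Partition} (B : BorderStrip κ ν) where
  open BorderStrip B

  borderStrip-step : ∀ i → part κ (suc i) ≤ suc (part ν i)
  borderStrip-step i = ≮⇒≥ λ big → no2×2 i (part ν i)
    ( (≤-refl , <-≤-trans (≤-trans (n≤1+n _) big) (part-suc≤ (proj₁ outer) i))
    , (n≤1+n _ , <-≤-trans big (part-suc≤ (proj₁ outer) i))
    , (part-suc≤ (proj₁ inner) i , ≤-trans (n≤1+n _) big)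
    , (≤-trans (part-suc≤ (proj₁ inner) i) (n≤1+n _) , big) )

nonempty⇔cell : ∀ {κ ν : Partition} {i} → part ν i < part κ i ⇔ (∃ λ j → InSkew κ ν (i , j))
nonempty⇔cell = mk⇔ (λ r → _ , ≤-refl , r) (λ (_ , ν≤j , j<κ) → ≤-<-trans ν≤j j<κ)

nonemptyRow-exists : ∀ {κ ν : Partition} → IsPartition ν → ν ⊆ₚ κ → 0 < size κ ∸ size ν → ∃ λ i → part ν i < part κ i
nonemptyRow-exists {κ} {ν} pν ν⊆κ 0<size with anyUpTo? (λ i → part ν i <? part κ i) (length κ)
... | yes (i , _ , r) = i , r
... | no none = ⊥-elim (<⇒≢ 0<size (sym (trans (cong (_∸ size ν) size≡) (n∸n≡0 (size ν)))))
  where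
  size≡ : size κ ≡ size ν
  size≡ = begin
    size κ                                 ≡⟨ size≡sum-parts κ ≤-refl ⟩
    sum (applyUpTo (part κ) (length κ))
      ≡⟨ cong sum (applyUpTo-cong (length κ) (λ i i<l → ≤-antisym (≮⇒≥ (λ r → none (i , i<l , r))) (ν⊆κ i))) ⟩
    sum (applyUpTo (part ν) (length κ))    ≡⟨ size≡sum-parts ν (length-mono {κ} pν ν⊆κ) ⟨
    size ν                                 ∎

module StripRows {κ ν : Partition} (B : BorderStrip κ ν) {c₀ : Cell} (s₀ : InSkew κ ν c₀) where
  open BorderStrip B

  NonemptyRow : ℕ → Set
  NonemptyRow i = part ν i < part κ i

  private
    decκ : WeaklyDecreasing κ
    decκ = proj₁ outer
    decν : WeaklyDecreasing ν
    decν = proj₁ inner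

    nonempty? : Decidable NonemptyRow
    nonempty? i = part ν i <? part κ i

    cell⇒nonempty : ∀ {i j} → InSkew κ ν (i , j) → NonemptyRow i
    cell⇒nonempty (ν≤j , j<κ) = ≤-<-trans ν≤j j<κ

    nonempty⇒<length : ∀ i → NonemptyRow i → i < length κ
    nonempty⇒<length i r = part-pos⇒<length κ (≤-<-trans z≤n r)

    first : ∃ λ a → NonemptyRow a × (∀ k → k < a → ¬ NonemptyRow k)
    first = least nonempty? (cell⇒nonempty s₀)
    final : ∃ λ b → NonemptyRow b × (∀ k → NonemptyRow k → k ≤ b)
    final = greatest nonempty? (cell⇒nonempty s₀) nonempty⇒<length

  a b : ℕ
  a = proj₁ first
  b = proj₁ final

  nonempty⇒between : ∀ {i} → NonemptyRow i → a ≤ i × i ≤ b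
  nonempty⇒between r = ≮⇒≥ (λ i<a → proj₂ (proj₂ first) _ i<a r) , proj₂ (proj₂ final) _ r

  a≤b : a ≤ b
  a≤b = let a≤i , i≤b = nonempty⇒between (cell⇒nonempty s₀) in ≤-trans a≤i i≤b

  private
    a↝b : Path κ ν (a , part ν a) (b , part ν b)
    a↝b = connected _ _ (≤-refl , proj₁ (proj₂ first)) (≤-refl , proj₁ (proj₂ final))

  between⇒nonempty : ∀ {i} → a ≤ i → i ≤ b → NonemptyRow i
  between⇒nonempty a≤i i≤b = cell⇒nonempty (proj₂ (Path-visitsRow a↝b _ a≤i i≤b))

  consecutiveRows : ∀ {i} → a ≤ i → i < b → part κ (suc i) ≡ suc (part ν i)
  consecutiveRows {i} a≤i i<b =
    let _ , (ν≤j , _) , (_ , j<κ) = Path-crossesRow a↝b i a≤i i<b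
    in ≤-antisym (borderStrip-step B i) (≤-<-trans ν≤j j<κ)

  cell⇒column : ∀ {i j} → InSkew κ ν (i , j) → part ν b ≤ j × j < part κ a
  cell⇒column s@(ν≤j , j<κ) = let a≤i , i≤b = nonempty⇒between (cell⇒nonempty s) in
    ≤-trans (part-antitone decν i≤b) ν≤j , <-≤-trans j<κ (part-antitone decκ a≤i)

  column⇒cell : ∀ {j} → part ν b ≤ j → j < part κ a → ∃ λ i → InSkew κ ν (i , j)
  column⇒cell {j} ν≤j j<κ = go b ≤-refl a≤b ν≤j
    where
    go : ∀ i → i ≤ b → a ≤ i → part ν i ≤ j → ∃ λ i → InSkew κ ν (i , j)
    go i i≤b a≤i νᵢ≤j with m≤n⇒m<n∨m≡n a≤i
    ... | inj₂ refl = a , νᵢ≤j , j<κ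
    go (suc i) i<b _ νᵢ≤j | inj₁ (s≤s a≤i) with part ν i ≤? j
    ... | yes ν≤j′ = go i (<⇒≤ i<b) a≤i ν≤j′
    ... | no ν≰j′  = suc i , νᵢ≤j , subst (j <_) (sym (consecutiveRows a≤i i<b)) (s≤s (<⇒≤ (≰⇒> ν≰j′)))

  private
    d e : ℕ
    d = b ∸ a
    e = length κ ∸ suc b

    length≡ : length κ ≡ a + suc (d + e)
    length≡ = begin
      length κ            ≡⟨ m+[n∸m]≡n (nonempty⇒<length b (proj₁ (proj₂ final))) ⟨
      suc b + e           ≡⟨ cong (λ x → suc x + e) (m+[n∸m]≡n a≤b) ⟨
      suc (a + d) + e     ≡⟨ cong suc (+-assoc a d e) ⟩
      suc (a + (d + e))   ≡⟨ +-suc a (d + e) ⟨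
      a + suc (d + e)     ∎

  ht≡ : ht κ ν ≡ b ∸ a
  ht≡ = cong (_∸ 1) (begin
    rows κ ν                                            ≡⟨ cong (length ∘ filter nonempty? ∘ upTo) length≡ ⟩
    length (filter nonempty? (upTo (a + suc (d + e))))  ≡⟨ length-filter-interval nonempty? a d e interval ⟩
    suc d                                               ∎)
    where
    interval : ∀ {i} → NonemptyRow i ⇔ (a ≤ i × i ≤ a + d)
    interval = mk⇔ (λ r → let a≤i , i≤b = nonempty⇒between r in a≤i , subst (_ ≤_) (sym (m+[n∸m]≡n a≤b)) i≤b)
                   (λ (a≤i , i≤a+d) → between⇒nonempty a≤i (subst (_ ≤_) (m+[n∸m]≡n a≤b) i≤a+d))

  private
    width : ℕ → ℕ
    width i = part κ i ∸ part ν i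

    width-empty : ∀ {i} → ¬ NonemptyRow i → width i ≡ 0
    width-empty ¬r = m≤n⇒m∸n≡0 (≮⇒≥ ¬r)

    telescope : ∀ d → a + d ≤ b → sum (applyUpTo (λ i → width (a + i)) (suc d)) + part ν (a + d) ≡ part κ a + d
    telescope zero _ = begin
      width (a + 0) + 0 + part ν (a + 0) ≡⟨ cong (λ x → width x + 0 + part ν x) (+-identityʳ a) ⟩
      width a + 0 + part ν a             ≡⟨ cong (_+ part ν a) (+-identityʳ (width a)) ⟩
      width a + part ν a                 ≡⟨ m∸n+n≡m (ν⊆κ a) ⟩
      part κ a                           ≡⟨ +-identityʳ (part κ a) ⟨
      part κ a + 0                       ∎
    telescope (suc d) a+d<b = begin
      sum (applyUpTo w (suc (suc d))) + part ν (a + suc d)        ≡⟨ cong (_+ part ν (a + suc d)) (sum-applyUpTo-suc w (suc d)) ⟩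
      sum (applyUpTo w (suc d)) + w (suc d) + part ν (a + suc d)  ≡⟨ +-assoc (sum (applyUpTo w (suc d))) _ _ ⟩
      sum (applyUpTo w (suc d)) + (w (suc d) + part ν (a + suc d)) ≡⟨ cong (sum (applyUpTo w (suc d)) +_) (m∸n+n≡m (ν⊆κ (a + suc d))) ⟩
      sum (applyUpTo w (suc d)) + part κ (a + suc d)               ≡⟨ cong (λ x → sum (applyUpTo w (suc d)) + part κ x) (+-suc a d) ⟩
      sum (applyUpTo w (suc d)) + part κ (suc (a + d))             ≡⟨ cong (sum (applyUpTo w (suc d)) +_) (consecutiveRows (m≤m+n a d) a+d<b′) ⟩
      sum (applyUpTo w (suc d)) + suc (part ν (a + d))             ≡⟨ +-suc _ _ ⟩
      suc (sum (applyUpTo w (suc d)) + part ν (a + d))             ≡⟨ cong suc (telescope d (<⇒≤ a+d<b′)) ⟩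
      suc (part κ a + d)                                           ≡⟨ +-suc (part κ a) d ⟨
      part κ a + suc d                                             ∎
      where
      w : ℕ → ℕ
      w i = width (a + i)
      a+d<b′ : a + d < b
      a+d<b′ = subst (_≤ b) (+-suc a d) a+d<b

  size-∸ : size κ ∸ size ν + part ν b ≡ part κ a + (b ∸ a)
  size-∸ = begin
    size κ ∸ size ν + part ν b                                              ≡⟨ cong (λ x → x ∸ size ν + part ν b) size-split ⟩
    size ν + sum (applyUpTo width (length κ)) ∸ size ν + part ν b          ≡⟨ cong (_+ part ν b) (m+n∸m≡n (size ν) _) ⟩
    sum (applyUpTo width (length κ)) + part ν b                             ≡⟨ cong (λ n → sum (applyUpTo width n) + part ν b) length≡ ⟩
    sum (applyUpTo width (a + (suc d + e))) + part ν b                      ≡⟨ cong (_+ part ν b) rows-a-to-b ⟩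
    sum (applyUpTo (λ i → width (a + i)) (suc d)) + part ν b
      ≡⟨ cong (λ x → sum (applyUpTo (λ i → width (a + i)) (suc d)) + part ν x) (m+[n∸m]≡n a≤b) ⟨
    sum (applyUpTo (λ i → width (a + i)) (suc d)) + part ν (a + d)          ≡⟨ telescope d (≤-reflexive (m+[n∸m]≡n a≤b)) ⟩
    part κ a + d                                                            ∎
    where
    size-split : size κ ≡ size ν + sum (applyUpTo width (length κ))
    size-split = begin
      size κ ≡⟨ size≡sum-parts κ ≤-refl ⟩
      sum (applyUpTo (part κ) (length κ)) ≡⟨ sum-applyUpTo-∸ (length κ) (λ i _ → ν⊆κ i) ⟨
      sum (applyUpTo (part ν) (length κ)) + sum (applyUpTo width (length κ))
        ≡⟨ cong (_+ sum (applyUpTo width (length κ))) (size≡sum-parts ν (length-mono {κ} inner ν⊆κ)) ⟨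
      size ν + sum (applyUpTo width (length κ)) ∎
    rows-a-to-b : sum (applyUpTo width (a + (suc d + e))) ≡ sum (applyUpTo (λ i → width (a + i)) (suc d))
    rows-a-to-b = begin
      sum (applyUpTo width (a + (suc d + e)))
        ≡⟨ sum-applyUpTo-+ width a (suc d + e) ⟩
      sum (applyUpTo width a) + sum (applyUpTo (λ i → width (a + i)) (suc d + e))
        ≡⟨ cong₂ _+_ (sum-applyUpTo-zero a (λ i i<a → width-empty (λ r → <⇒≱ i<a (proj₁ (nonempty⇒between r)))))
                     (sum-applyUpTo-+ (λ i → width (a + i)) (suc d) e) ⟩
      sum (applyUpTo (λ i → width (a + i)) (suc d)) + sum (applyUpTo (λ i → width (a + (suc d + i))) e)
        ≡⟨ cong (sum (applyUpTo (λ i → width (a + i)) (suc d)) +_) (sum-applyUpTo-zero e (λ i _ → width-empty (λ r →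
             <⇒≱ (+-monoʳ-< a (s≤s (m≤m+n d i))) (b-bound (proj₂ (nonempty⇒between r)))))) ⟩
      sum (applyUpTo (λ i → width (a + i)) (suc d)) + 0
        ≡⟨ +-identityʳ _ ⟩
      sum (applyUpTo (λ i → width (a + i)) (suc d)) ∎
      where
      b-bound : ∀ {i} → i ≤ b → i ≤ a + d
      b-bound = subst (_ ≤_) (sym (m+[n∸m]≡n a≤b))

  rowsInterval : ∀ {i} → NonemptyRow i ⇔ (a ≤ i × i < suc b)
  rowsInterval = mk⇔ (λ r → let a≤i , i≤b = nonempty⇒between r in a≤i , s≤s i≤b)
                     (λ (a≤i , i<b) → between⇒nonempty a≤i (s≤s⁻¹ i<b))

  columnsInterval : ∀ {j} → (∃ λ i → InSkew κ ν (i , j)) ⇔ (part ν b ≤ j × j < part κ a)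
  columnsInterval = mk⇔ (λ (_ , s) → cell⇒column s) (λ (ν≤j , j<κ) → column⇒cell ν≤j j<κ)

module ConjugateRows {κ ν : Partition} (B : BorderStrip κ ν) {c₀ : Cell} (s₀ : InSkew κ ν c₀) where
  open BorderStrip B
  open StripRows B s₀

  private
    InSkew-conj : ∀ {c} → InSkew κ ν c ⇔ InSkew (conj κ) (conj ν) (transpose c)
    InSkew-conj = InSkew-conj⇔ (proj₁ outer) (proj₁ inner)

    conjRow⇔column : ∀ {i} → (∃ λ j → InSkew (conj κ) (conj ν) (i , j)) ⇔ (∃ λ j → InSkew κ ν (j , i))
    conjRow⇔column = mk⇔ (λ (j , s) → j , Equivalence.from InSkew-conj s) (λ (j , s) → j , Equivalence.to InSkew-conj s)

    conjColumn⇔row : ∀ {j} → (∃ λ i → InSkew (conj κ) (conj ν) (i , j)) ⇔ (∃ λ i → InSkew κ ν (j , i))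
    conjColumn⇔row = mk⇔ (λ (i , s) → i , Equivalence.from InSkew-conj s) (λ (i , s) → i , Equivalence.to InSkew-conj s)

  s₀′ : InSkew (conj κ) (conj ν) (part ν a , a)
  s₀′ = Equivalence.to (InSkew-conj {a , part ν a}) (≤-refl , between⇒nonempty ≤-refl a≤b)

  module R′ = StripRows (borderStrip-conj B) s₀′

  conjRows : R′.a ≡ part ν b × suc R′.b ≡ part κ a
  conjRows = interval-unique
    (columnsInterval ⇔-∘ (conjRow⇔column ⇔-∘ (nonempty⇔cell {conj κ} {conj ν} ⇔-∘ ⇔-sym R′.rowsInterval))) (s≤s R′.a≤b)

  conjColumns : a ≡ part (conj ν) R′.b × suc b ≡ part (conj κ) R′.a
  conjColumns = interval-unique
    (R′.columnsInterval ⇔-∘ (⇔-sym conjColumn⇔row ⇔-∘ (nonempty⇔cell {κ} {ν} ⇔-∘ ⇔-sym rowsInterval))) (s≤s a≤b)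

  private
    d D : ℕ
    d = b ∸ a
    D = R′.b ∸ R′.a

    size-∸≡suc[d+D] : size κ ∸ size ν ≡ suc (d + D)
    size-∸≡suc[d+D] = +-cancelʳ-≡ (part ν b) _ _ (begin
      size κ ∸ size ν + part ν b     ≡⟨ size-∸ ⟩
      part κ a + d                   ≡⟨ cong (_+ d) (proj₂ conjRows) ⟨
      suc R′.b + d                   ≡⟨ cong (λ x → suc x + d) (m+[n∸m]≡n R′.a≤b) ⟨
      suc (R′.a + D) + d             ≡⟨ cong (λ x → suc (x + D) + d) (proj₁ conjRows) ⟩
      suc (part ν b + D) + d         ≡⟨ rearrange (part ν b) D d ⟩
      suc (d + D) + part ν b         ∎)
      where
      rearrange : ∀ x y z → suc (x + y) + z ≡ suc (z + y) + x
      rearrange = solve-∀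

  size-∸≡suc[ht+ht′] : size κ ∸ size ν ≡ suc (ht κ ν + ht (conj κ) (conj ν))
  size-∸≡suc[ht+ht′] = trans size-∸≡suc[d+D] (cong₂ (λ x y → suc (x + y)) (sym ht≡) (sym R′.ht≡))

  size-∸-conj : size κ ∸ size ν + part (conj ν) R′.b ≡ part (conj κ) R′.a + (R′.b ∸ R′.a)
  size-∸-conj = begin
    size κ ∸ size ν + part (conj ν) R′.b   ≡⟨ cong₂ _+_ size-∸≡suc[d+D] (sym (proj₁ conjColumns)) ⟩
    suc (d + D) + a                        ≡⟨ rearrange a d D ⟩
    suc (a + d) + D                        ≡⟨ cong (λ x → suc x + D) (m+[n∸m]≡n a≤b) ⟩
    suc b + D                              ≡⟨ cong (_+ D) (proj₂ conjColumns) ⟩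
    part (conj κ) R′.a + D                 ∎
    where
    rearrange : ∀ x y z → suc (y + z) + x ≡ suc (x + y) + z
    rearrange = solve-∀

record BeadMove (t : ℕ) (β β′ : List ℕ) : Set where
  field
    before passed after : List ℕ
    x      : ℕ
    source : β ≡ before ++ passed ++ x ∷ after
    target : β′ ≡ before ++ (x + t) ∷ passed ++ after
    passed-between : All (λ y → x < y × y < x + t) passed
    below-decreasing : StrictlyDecreasing (x ∷ after)

beadMove-resp : ∀ {t β₁ β₂ β′₁ β′₂} → β₁ ≡ β₂ → β′₁ ≡ β′₂ → BeadMove t β₂ β′₂ → BeadMove t β₁ β′₁
beadMove-resp β₁≡β₂ β′₁≡β′₂ m = record
  { before = before ; passed = passed ; after = after ; x = x
  ; source = trans β₁≡β₂ source ; target = trans β′₁≡β′₂ target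
  ; passed-between = passed-between ; below-decreasing = below-decreasing }
  where open BeadMove m

DecreasingBelow : ℕ → (ℕ → ℕ) → Set
DecreasingBelow n f = ∀ {i j} → i < j → j < n → f j < f i

beadMove-applyUpTo : ∀ t (ψ φ : ℕ → ℕ) a d e → let n = a + suc (d + e) in
  DecreasingBelow n ψ → DecreasingBelow n φ →
  (∀ i → i < a → φ i ≡ ψ i) →
  φ a ≡ ψ (a + d) + t →
  (∀ i → i < d → φ (a + suc i) ≡ ψ (a + i)) →
  (∀ i → φ (a + suc (d + i)) ≡ ψ (a + suc (d + i))) →
  BeadMove t (applyUpTo ψ n) (applyUpTo φ n)
beadMove-applyUpTo t ψ φ a d e ψ↓ φ↓ φ≡ψ-above φ[a] φ≡ψ-shifted φ≡ψ-below = record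
  { before = applyUpTo ψ a
  ; passed = applyUpTo (λ i → ψ (a + i)) d
  ; after  = applyUpTo (λ i → ψ (a + suc (d + i))) e
  ; x      = ψ (a + d)
  ; source = applyUpTo-around ψ a d e
  ; target = target
  ; passed-between = All-applyUpTo _ d (λ i i<d →
        ψ↓ (+-monoʳ-< a i<d) (a+i<n d ≤-refl)
      , subst (_< ψ (a + d) + t) (φ≡ψ-shifted i i<d) (subst (φ (a + suc i) <_) φ[a]
          (φ↓ (m<m+n a z<s) (a+i<n (suc i) i<d))))
  ; below-decreasing = subst StrictlyDecreasing
      (cong₂ _∷_ (cong (λ k → ψ (a + k)) (+-identityʳ d)) (applyUpTo-cong e (λ i _ → cong (λ k → ψ (a + k)) (+-suc d i))))
      (applyUpTo-Linked (λ i → ψ (a + (d + i))) (suc e) λ i i<e →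
        ψ↓ (+-monoʳ-< a (+-monoʳ-< d (n<1+n i))) (+-monoʳ-< a (s≤s (+-monoʳ-≤ d (s≤s⁻¹ i<e)))))
  }
  where
  n : ℕ
  n = a + suc (d + e)
  a+i<n : ∀ i → i ≤ d → a + i < n
  a+i<n i i≤d = +-monoʳ-< a (s≤s (≤-trans i≤d (m≤m+n d e)))
  target : applyUpTo φ n ≡ applyUpTo ψ a ++ (ψ (a + d) + t) ∷ applyUpTo (λ i → ψ (a + i)) d ++ applyUpTo (λ i → ψ (a + suc (d + i))) e
  target = begin
    applyUpTo φ (a + suc (d + e))                  ≡⟨ applyUpTo-around φ a 0 (d + e) ⟩
    applyUpTo φ a ++ φ (a + 0) ∷ applyUpTo (λ i → φ (a + suc i)) (d + e)
      ≡⟨ cong₂ _++_ (applyUpTo-cong a φ≡ψ-above)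
                    (cong₂ _∷_ (trans (cong φ (+-identityʳ a)) φ[a]) (applyUpTo-+ (λ i → φ (a + suc i)) d e)) ⟩
    applyUpTo ψ a ++ (ψ (a + d) + t) ∷ applyUpTo (λ i → φ (a + suc i)) d ++ applyUpTo (λ i → φ (a + suc (d + i))) e
      ≡⟨ cong (λ l → applyUpTo ψ a ++ (ψ (a + d) + t) ∷ l)
              (cong₂ _++_ (applyUpTo-cong d φ≡ψ-shifted) (applyUpTo-cong e (λ i _ → φ≡ψ-below i))) ⟩
    applyUpTo ψ a ++ (ψ (a + d) + t) ∷ applyUpTo (λ i → ψ (a + i)) d ++ applyUpTo (λ i → ψ (a + suc (d + i))) e ∎

bead : Partition → ℕ → ℕ → ℕ
bead L N i = part L i + (N ∸ suc i)

beta≡applyUpTo : ∀ L N → beta L N ≡ applyUpTo (bead L N) N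
beta≡applyUpTo L N = map-applyUpTo id (bead L N) N

bead-decreasing : ∀ {L} → WeaklyDecreasing L → ∀ N → DecreasingBelow N (bead L N)
bead-decreasing dec N {i} i<j j<N = +-mono-≤-< (part-antitone dec (<⇒≤ i<j)) (∸-monoʳ-< (s≤s i<j) j<N)

module StripMove {κ ν : Partition} (B : BorderStrip κ ν) {c₀ : Cell} (s₀ : InSkew κ ν c₀) (t : ℕ)
  (t+ν[b]≡κ[a]+d : t + part ν (StripRows.b B s₀) ≡ part κ (StripRows.a B s₀) + (StripRows.b B s₀ ∸ StripRows.a B s₀))
  where
  open BorderStrip B
  open StripRows B s₀

  private
    d : ℕ
    d = b ∸ a
    a+d≡b : a + d ≡ b
    a+d≡b = m+[n∸m]≡n a≤b

    emptyRow : ∀ {i} → ¬ NonemptyRow i → part κ i ≡ part ν i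
    emptyRow {i} ¬r = ≤-antisym (≮⇒≥ ¬r) (ν⊆κ i)

    module RowsBelow (e : ℕ) where
      N : ℕ
      N = a + suc (d + e)

      offset : ∀ k → N ∸ suc (a + k) ≡ d + e ∸ k
      offset k = trans (cong (N ∸_) (sym (+-suc a k))) ([m+n]∸[m+o]≡n∸o a (suc (d + e)) (suc k))

      above : ∀ i → i < a → bead κ N i ≡ bead ν N i
      above i i<a = cong (_+ (N ∸ suc i)) (emptyRow (λ r → <⇒≱ i<a (proj₁ (nonempty⇒between r))))

      below : ∀ i → bead κ N (a + suc (d + i)) ≡ bead ν N (a + suc (d + i))
      below i = cong (_+ (N ∸ suc (a + suc (d + i))))
        (emptyRow (λ r → <⇒≱ (subst (_< a + suc (d + i)) a+d≡b (+-monoʳ-< a (s≤s (m≤m+n d i)))) (proj₂ (nonempty⇒between r))))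

      moved : bead κ N a ≡ bead ν N (a + d) + t
      moved = begin
        part κ a + (N ∸ suc a)            ≡⟨ cong (λ k → part κ a + (N ∸ suc k)) (+-identityʳ a) ⟨
        part κ a + (N ∸ suc (a + 0))      ≡⟨ cong (part κ a +_) (offset 0) ⟩
        part κ a + (d + e)                ≡⟨ +-assoc (part κ a) d e ⟨
        part κ a + d + e                  ≡⟨ cong (_+ e) (trans (sym t+ν[b]≡κ[a]+d) (cong (λ k → t + part ν k) (sym a+d≡b))) ⟩
        t + part ν (a + d) + e            ≡⟨ rearrange t (part ν (a + d)) e ⟩
        part ν (a + d) + e + t            ≡⟨ cong (λ k → part ν (a + d) + k + t) (trans (offset d) (m+n∸m≡n d e)) ⟨
        part ν (a + d) + (N ∸ suc (a + d)) + t ∎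
        where
        rearrange : ∀ x y z → x + y + z ≡ y + z + x
        rearrange = solve-∀

      shifted : ∀ i → i < d → bead κ N (a + suc i) ≡ bead ν N (a + i)
      shifted i i<d = begin
        part κ (a + suc i) + (N ∸ suc (a + suc i))       ≡⟨ cong (λ k → part κ k + (N ∸ suc k)) (+-suc a i) ⟩
        part κ (suc (a + i)) + (N ∸ suc (suc (a + i)))   ≡⟨ cong (_+ (N ∸ suc (suc (a + i))))
                                                              (consecutiveRows (m≤m+n a i) (subst (a + i <_) a+d≡b (+-monoʳ-< a i<d))) ⟩
        suc (part ν (a + i)) + (N ∸ suc (suc (a + i)))   ≡⟨ +-suc (part ν (a + i)) _ ⟨
        part ν (a + i) + suc (N ∸ suc (suc (a + i)))     ≡⟨ cong (part ν (a + i) +_) (+-∸-assoc 1 {N} {suc (suc (a + i))} a+i+2≤N) ⟨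
        part ν (a + i) + (N ∸ suc (a + i))               ∎
        where
        a+i+2≤N : suc (suc (a + i)) ≤ N
        a+i+2≤N = subst (_≤ N) (trans (+-suc a (suc i)) (cong suc (+-suc a i))) (+-monoʳ-≤ a (s≤s (≤-trans i<d (m≤m+n d e))))

      beadMoveAt : BeadMove t (beta ν N) (beta κ N)
      beadMoveAt = beadMove-resp (beta≡applyUpTo ν N) (beta≡applyUpTo κ N)
        (beadMove-applyUpTo t (bead ν N) (bead κ N) a d e
          (bead-decreasing (proj₁ inner) N) (bead-decreasing (proj₁ outer) N) above moved shifted below)

  beadMove : ∀ N → length κ ≤ N → BeadMove t (beta ν N) (beta κ N)
  beadMove N κ≤N = beadMove-resp (cong (beta ν) (sym N≡)) (cong (beta κ) (sym N≡)) (RowsBelow.beadMoveAt (N ∸ suc b))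
    where
    N≡ : a + suc (d + (N ∸ suc b)) ≡ N
    N≡ = begin
      a + suc (d + (N ∸ suc b))   ≡⟨ +-suc a _ ⟩
      suc (a + (d + (N ∸ suc b))) ≡⟨ cong suc (+-assoc a d _) ⟨
      suc (a + d + (N ∸ suc b))   ≡⟨ cong (λ k → suc (k + (N ∸ suc b))) a+d≡b ⟩
      suc b + (N ∸ suc b)         ≡⟨ m+[n∸m]≡n (<-≤-trans (part-pos⇒<length κ (≤-<-trans z≤n (between⇒nonempty a≤b ≤-refl))) κ≤N) ⟩
      N                           ∎

  length-passed : ∀ N (κ≤N : length κ ≤ N) → length (BeadMove.passed (beadMove N κ≤N)) ≡ ht κ ν
  length-passed N _ = trans (length-applyUpTo _ d) (sym ht≡)

-- Increasing pairs

increasingPairs : List ℕ → ℕ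
increasingPairs []      = 0
increasingPairs (x ∷ l) = countAbove x l + increasingPairs l

countAbove-swap : ∀ y A u v B → countAbove y (A ++ u ∷ v ∷ B) ≡ countAbove y (A ++ v ∷ u ∷ B)
countAbove-swap y A u v B = ↭-length (filter-↭ (y <?_) (++⁺ˡ A (↭-swap u v ↭-refl)))

increasingPairs-swap : ∀ A {u v} B → u < v → increasingPairs (A ++ u ∷ v ∷ B) ≡ suc (increasingPairs (A ++ v ∷ u ∷ B))
increasingPairs-swap (y ∷ A) B u<v = trans (cong₂ _+_ (countAbove-swap y A _ _ B) (increasingPairs-swap A B u<v))
                                           (+-suc (countAbove y (A ++ _ ∷ _ ∷ B)) _)
increasingPairs-swap [] {u} {v} B u<v
  rewrite filter-accept (u <?_) {v} {B} u<v | filter-reject (v <?_) {u} {B} (<⇒≯ u<v) =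
  rearrange (countAbove u B) (countAbove v B) (increasingPairs B)
  where
  rearrange : ∀ x y z → suc x + (y + z) ≡ suc (y + (x + z))
  rearrange = solve-∀

parity-increasingPairs-swap : ∀ A {u v} B → u ≢ v →
  parity (increasingPairs (A ++ u ∷ v ∷ B)) ≡ parity (suc (increasingPairs (A ++ v ∷ u ∷ B)))
parity-increasingPairs-swap A {u} {v} B u≢v with <-cmp u v
... | tri< u<v _ _ = cong parity (increasingPairs-swap A B u<v)
... | tri≈ _ u≡v _ = ⊥-elim (u≢v u≡v)
... | tri> _ _ v<u = cong (parity ∘ suc) (sym (increasingPairs-swap A B v<u))

parity-increasingPairs-move : ∀ A s Y B → All (_≢ s) Y →
  parity (increasingPairs (A ++ s ∷ Y ++ B)) ≡ parity (increasingPairs (A ++ Y ++ s ∷ B) + length Y)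
parity-increasingPairs-move A s [] B [] = cong parity (sym (+-identityʳ (increasingPairs (A ++ s ∷ B))))
parity-increasingPairs-move A s (y ∷ Y) B (y≢s ∷ Y≢s) = begin
  parity (increasingPairs (A ++ s ∷ y ∷ Y ++ B))            ≡⟨ parity-increasingPairs-swap A (Y ++ B) (y≢s ∘ sym) ⟩
  parity (1 + increasingPairs (A ++ y ∷ s ∷ Y ++ B))        ≡⟨ ℙ.+-homo-+ 1 (increasingPairs (A ++ y ∷ s ∷ Y ++ B)) ⟩
  parity 1 ℙ.+ parity (increasingPairs (A ++ y ∷ s ∷ Y ++ B))
    ≡⟨ cong (λ l → parity 1 ℙ.+ parity (increasingPairs l)) (sym (++-assoc A [ y ] (s ∷ Y ++ B))) ⟩
  parity 1 ℙ.+ parity (increasingPairs ((A ++ [ y ]) ++ s ∷ Y ++ B))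
    ≡⟨ cong (parity 1 ℙ.+_) (parity-increasingPairs-move (A ++ [ y ]) s Y B Y≢s) ⟩
  parity 1 ℙ.+ parity (increasingPairs ((A ++ [ y ]) ++ Y ++ s ∷ B) + length Y)
    ≡⟨ cong (λ l → parity 1 ℙ.+ parity (increasingPairs l + length Y)) (++-assoc A [ y ] (Y ++ s ∷ B)) ⟩
  parity 1 ℙ.+ parity (increasingPairs (A ++ y ∷ Y ++ s ∷ B) + length Y)
    ≡⟨ ℙ.+-homo-+ 1 (increasingPairs (A ++ y ∷ Y ++ s ∷ B) + length Y) ⟨
  parity (1 + (increasingPairs (A ++ y ∷ Y ++ s ∷ B) + length Y))
    ≡⟨ cong parity (+-suc (increasingPairs (A ++ y ∷ Y ++ s ∷ B)) (length Y)) ⟨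
  parity (increasingPairs (A ++ y ∷ Y ++ s ∷ B) + suc (length Y)) ∎

shiftedParts : ℕ → ℕ → List ℕ → List ℕ
shiftedParts m k []       = []
shiftedParts m k (x ∷ xs) = (x + k ∸ m) ∷ shiftedParts m (suc k) xs

module _ (m : ℕ) (F : ℕ → List ℕ → List ℕ) (F[] : ∀ k → F k [] ≡ [])
         (F∷ : ∀ k x l → F k (x ∷ l) ≡ (x + k ∸ m) ∷ F (suc k) l) where

  shiftedParts-unique : ∀ k l → F k l ≡ shiftedParts m k l
  shiftedParts-unique k []      = F[] k
  shiftedParts-unique k (x ∷ l) = trans (F∷ k x l) (cong ((x + k ∸ m) ∷_) (shiftedParts-unique (suc k) l))

private
  -- quotParts is defined through a local function that cannot be named here; the `with`s turn its
  -- arguments into variables, so that shiftedParts-unique can identify it by its defining equations.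
  tail-quotParts : ∀ x l → drop 1 (quotParts (x ∷ l)) ≡ shiftedParts (suc (length l)) 2 l
  tail-quotParts x l with x ∷ l in eq
  ... | ξ with shiftedParts-unique (length ξ) _ (λ _ → refl) (λ _ _ _ → refl) | 2 | l in eq′
  ...   | go≡ | k | w = trans (go≡ k w) (cong (λ m → shiftedParts m k w) (trans (cong length (sym eq)) (cong (suc ∘ length) eq′)))

quotParts≡shiftedParts : ∀ ξ → quotParts ξ ≡ shiftedParts (length ξ) 1 ξ
quotParts≡shiftedParts []      = refl
quotParts≡shiftedParts (x ∷ l) = cong ((x + 1 ∸ suc (length l)) ∷_) (tail-quotParts x l)

private
  length-middle : ∀ (l₁ : List ℕ) {x y} l₂ → length (l₁ ++ x ∷ l₂) ≡ length (l₁ ++ y ∷ l₂)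
  length-middle []       l₂ = refl
  length-middle (_ ∷ l₁) l₂ = cong suc (length-middle l₁ l₂)

  sum-shiftedParts-bump : ∀ m k l₁ d l₂ → m ≤ d + (k + length l₁) →
    sum (shiftedParts m k (l₁ ++ suc d ∷ l₂)) ≡ suc (sum (shiftedParts m k (l₁ ++ d ∷ l₂)))
  sum-shiftedParts-bump m k [] d l₂ m≤ =
    cong (_+ sum (shiftedParts m (suc k) l₂)) (+-∸-assoc 1 (subst (m ≤_) (cong (d +_) (+-identityʳ k)) m≤))
  sum-shiftedParts-bump m k (y ∷ l₁) d l₂ m≤ =
    trans (cong (y + k ∸ m +_) (sum-shiftedParts-bump m (suc k) l₁ d l₂ (subst (λ n → m ≤ d + n) (+-suc k (length l₁)) m≤)))
          (+-suc _ _)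

  sum-shiftedParts-pad : ∀ m k ξ →
    sum (shiftedParts (suc m) k (map suc ξ ++ [ 0 ])) ≡ sum (shiftedParts m k ξ) + (k + length ξ ∸ suc m)
  sum-shiftedParts-pad m k []      = trans (+-identityʳ _) (cong (_∸ suc m) (sym (+-identityʳ k)))
  sum-shiftedParts-pad m k (x ∷ ξ) = begin
    x + k ∸ m + sum (shiftedParts (suc m) (suc k) (map suc ξ ++ [ 0 ]))
      ≡⟨ cong (x + k ∸ m +_) (sum-shiftedParts-pad m (suc k) ξ) ⟩
    x + k ∸ m + (sum (shiftedParts m (suc k) ξ) + (suc k + length ξ ∸ suc m))
      ≡⟨ +-assoc (x + k ∸ m) _ _ ⟨
    x + k ∸ m + sum (shiftedParts m (suc k) ξ) + (suc k + length ξ ∸ suc m)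
      ≡⟨ cong (λ n → x + k ∸ m + sum (shiftedParts m (suc k) ξ) + (n ∸ suc m)) (+-suc k (length ξ)) ⟨
    x + k ∸ m + sum (shiftedParts m (suc k) ξ) + (k + suc (length ξ) ∸ suc m) ∎

size-quotParts-bump : ∀ l₁ d l₂ → length l₂ ≤ d →
  size (quotParts (l₁ ++ suc d ∷ l₂)) ≡ suc (size (quotParts (l₁ ++ d ∷ l₂)))
size-quotParts-bump l₁ d l₂ l₂≤d = begin
  size (quotParts (l₁ ++ suc d ∷ l₂))                        ≡⟨ cong sum (quotParts≡shiftedParts (l₁ ++ suc d ∷ l₂)) ⟩
  sum (shiftedParts (length (l₁ ++ suc d ∷ l₂)) 1 (l₁ ++ suc d ∷ l₂))
    ≡⟨ cong (λ m → sum (shiftedParts m 1 (l₁ ++ suc d ∷ l₂))) (length-middle l₁ l₂) ⟩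
  sum (shiftedParts (length (l₁ ++ d ∷ l₂)) 1 (l₁ ++ suc d ∷ l₂)) ≡⟨ sum-shiftedParts-bump _ 1 l₁ d l₂ length≤ ⟩
  suc (sum (shiftedParts (length (l₁ ++ d ∷ l₂)) 1 (l₁ ++ d ∷ l₂))) ≡⟨ cong (suc ∘ sum) (quotParts≡shiftedParts (l₁ ++ d ∷ l₂)) ⟨
  suc (size (quotParts (l₁ ++ d ∷ l₂)))                      ∎
  where
  length≤ : length (l₁ ++ d ∷ l₂) ≤ d + suc (length l₁)
  length≤ = subst (_≤ d + suc (length l₁)) (sym (length-++ l₁))
    (≤-trans (+-monoʳ-≤ (length l₁) (s≤s l₂≤d))
             (≤-reflexive (trans (+-suc (length l₁) d) (trans (cong suc (+-comm (length l₁) d)) (sym (+-suc d (length l₁)))))))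

size-quotParts-pad : ∀ ξ → size (quotParts (map suc ξ ++ [ 0 ])) ≡ size (quotParts ξ)
size-quotParts-pad ξ = begin
  size (quotParts (map suc ξ ++ [ 0 ]))                        ≡⟨ cong sum (quotParts≡shiftedParts (map suc ξ ++ [ 0 ])) ⟩
  sum (shiftedParts (length (map suc ξ ++ [ 0 ])) 1 (map suc ξ ++ [ 0 ]))
    ≡⟨ cong (λ m → sum (shiftedParts m 1 (map suc ξ ++ [ 0 ]))) length≡ ⟩
  sum (shiftedParts (suc (length ξ)) 1 (map suc ξ ++ [ 0 ]))  ≡⟨ sum-shiftedParts-pad (length ξ) 1 ξ ⟩
  sum (shiftedParts (length ξ) 1 ξ) + (suc (length ξ) ∸ suc (length ξ))
    ≡⟨ cong (sum (shiftedParts (length ξ) 1 ξ) +_) (n∸n≡0 (length ξ)) ⟩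
  sum (shiftedParts (length ξ) 1 ξ) + 0                       ≡⟨ +-identityʳ _ ⟩
  sum (shiftedParts (length ξ) 1 ξ)                           ≡⟨ cong sum (quotParts≡shiftedParts ξ) ⟨
  size (quotParts ξ)                                          ∎
  where
  length≡ : length (map suc ξ ++ [ 0 ]) ≡ suc (length ξ)
  length≡ = trans (length-++ (map suc ξ)) (trans (cong (_+ 1) (length-map suc ξ)) (+-comm (length ξ) 1))

-- The t-abacus

-- Writing t = suc k makes modt t and divt t reduce to _%_ and _/_.
module Abacus (k : ℕ) where

  t : ℕ
  t = suc k

  private
    %-+t : ∀ x → (x + t) % t ≡ x % t
    %-+t x = [m+n]%n≡m%n x t

    /-+t : ∀ x → (x + t) / t ≡ suc (x / t)
    /-+t x = trans (m/n≡1+[m∸n]/n (m≤n+m t x)) (cong (λ y → suc (y / t)) (m+n∸n≡m x t))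

    /-<-sameResidue : ∀ {x y} → y < x → y % t ≡ x % t → y / t < x / t
    /-<-sameResidue {x} {y} y<x same = ≰⇒> λ x/t≤y/t → <⇒≱ y<x
      (subst₂ _≤_ (sym (m≡m%n+[m/n]*n x t)) (sym (m≡m%n+[m/n]*n y t))
        (+-mono-≤ (≤-reflexive (sym same)) (*-monoˡ-≤ t x/t≤y/t)))

    %-≢-within : ∀ {x y} → x < y → y < x + t → y % t ≢ x % t
    %-≢-within {x} {y} x<y y<x+t same = <⇒≱ y<x+t
      (subst₂ _≤_ x+t≡ (sym (m≡m%n+[m/n]*n y t))
        (+-mono-≤ (≤-reflexive (sym same)) (*-monoˡ-≤ t (/-<-sameResidue x<y (sym same)))))
      where
      x+t≡ : x % t + suc (x / t) * t ≡ x + t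
      x+t≡ = begin
        x % t + (t + (x / t) * t) ≡⟨ cong (x % t +_) (+-comm t ((x / t) * t)) ⟩
        x % t + ((x / t) * t + t) ≡⟨ +-assoc (x % t) _ t ⟨
        x % t + (x / t) * t + t   ≡⟨ cong (_+ t) (m≡m%n+[m/n]*n x t) ⟨
        x + t                     ∎

  runner : ℕ → List ℕ → List ℕ
  runner r = filter (λ b → modt t b ≟ r)

  private
    runner-accept : ∀ {r} y l → y % t ≡ r → runner r (y ∷ l) ≡ y ∷ runner r l
    runner-accept {r} y l = filter-accept (λ b → modt t b ≟ r) {y} {l}

    runner-reject : ∀ {r} y l → y % t ≢ r → runner r (y ∷ l) ≡ runner r l
    runner-reject {r} y l = filter-reject (λ b → modt t b ≟ r) {y} {l}

    runner-none : ∀ {r} Y → All (λ y → y % t ≢ r) Y → runner r Y ≡ []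
    runner-none {r} Y = filter-none (λ b → modt t b ≟ r)

    runner-+t : ∀ r X → runner r (map (_+ t) X) ≡ map (_+ t) (runner r X)
    runner-+t r [] = refl
    runner-+t r (y ∷ X) with y % t ≟ r
    ... | yes y≡r = begin
      runner r ((y + t) ∷ map (_+ t) X)   ≡⟨ runner-accept {r} (y + t) (map (_+ t) X) (trans (%-+t y) y≡r) ⟩
      (y + t) ∷ runner r (map (_+ t) X)   ≡⟨ cong ((y + t) ∷_) (runner-+t r X) ⟩
      (y + t) ∷ map (_+ t) (runner r X)   ≡⟨ cong (map (_+ t)) (runner-accept {r} y X y≡r) ⟨
      map (_+ t) (runner r (y ∷ X))       ∎
    ... | no y≢r = begin
      runner r ((y + t) ∷ map (_+ t) X)   ≡⟨ runner-reject {r} (y + t) (map (_+ t) X) (y≢r ∘ trans (sym (%-+t y))) ⟩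
      runner r (map (_+ t) X)             ≡⟨ runner-+t r X ⟩
      map (_+ t) (runner r X)             ≡⟨ cong (map (_+ t)) (runner-reject {r} y X y≢r) ⟨
      map (_+ t) (runner r (y ∷ X))       ∎

    length-runner-below : ∀ x B → StrictlyDecreasing (x ∷ B) → length (runner (x % t) B) ≤ x / t
    length-runner-below x []      _           = z≤n
    length-runner-below x (y ∷ B) (y<x ∷ dec) with y % t ≟ x % t
    ... | yes same = subst (λ l → length l ≤ x / t) (sym (runner-accept {x % t} y B same))
          (<-≤-trans (s≤s (subst (λ r → length (runner r B) ≤ y / t) same (length-runner-below y B dec)))
                     (/-<-sameResidue y<x same))
    ... | no differ = subst (λ l → length l ≤ x / t) (sym (runner-reject {x % t} y B differ))
          (length-runner-below x B (skip y<x dec))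
      where
      skip : ∀ {x y} {B : List ℕ} → y < x → StrictlyDecreasing (y ∷ B) → StrictlyDecreasing (x ∷ B)
      skip y<x [-]          = [-]
      skip y<x (z<y ∷ dec) = <-trans z<y y<x ∷ dec

  runnerSize : Partition → ℕ → ℕ → ℕ
  runnerSize L N r = size (quotParts (map (divt t) (runner r (beta L N))))

  quotientSizeAt : Partition → ℕ → ℕ
  quotientSizeAt L N = sum (map (runnerSize L N) (upTo t))

  residuePairs : Partition → ℕ → ℕ
  residuePairs L N = increasingPairs (map (modt t) (beta L N))

  module _ {N : ℕ} {ν κ : Partition} (m : BeadMove t (beta ν N) (beta κ N)) where
    open BeadMove m

    private
      s : ℕ
      s = x % t

      passed-otherRunners : All (λ y → y % t ≢ s) passed
      passed-otherRunners = All.map (λ (x<y , y<x+t) → %-≢-within x<y y<x+t) passed-between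

      runnerSize-other : ∀ r → r ≢ s → runnerSize κ N r ≡ runnerSize ν N r
      runnerSize-other r r≢s = cong (λ l → size (quotParts (map (divt t) l))) (begin
        runner r (beta κ N)                                   ≡⟨ cong (runner r) target ⟩
        runner r (before ++ (x + t) ∷ passed ++ after)        ≡⟨ filter-++ _ before _ ⟩
        runner r before ++ runner r ((x + t) ∷ passed ++ after)
          ≡⟨ cong (runner r before ++_) (trans (runner-reject (x + t) (passed ++ after) (r≢s ∘ sym ∘ trans (sym (%-+t x))))
                                              (filter-++ _ passed after)) ⟩
        runner r before ++ runner r passed ++ runner r after
          ≡⟨ cong (λ l → runner r before ++ runner r passed ++ l) (runner-reject x after (r≢s ∘ sym)) ⟨
        runner r before ++ runner r passed ++ runner r (x ∷ after)
          ≡⟨ cong (runner r before ++_) (filter-++ _ passed (x ∷ after)) ⟨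
        runner r before ++ runner r (passed ++ x ∷ after)     ≡⟨ filter-++ _ before _ ⟨
        runner r (before ++ passed ++ x ∷ after)              ≡⟨ cong (runner r) source ⟨
        runner r (beta ν N)                                   ∎)

      runner-moved : runner s (beta κ N) ≡ runner s before ++ (x + t) ∷ runner s after
      runner-moved = begin
        runner s (beta κ N)                                   ≡⟨ cong (runner s) target ⟩
        runner s (before ++ (x + t) ∷ passed ++ after)        ≡⟨ filter-++ _ before _ ⟩
        runner s before ++ runner s ((x + t) ∷ passed ++ after)
          ≡⟨ cong (runner s before ++_) (runner-accept (x + t) (passed ++ after) (%-+t x)) ⟩
        runner s before ++ (x + t) ∷ runner s (passed ++ after)
          ≡⟨ cong (λ l → runner s before ++ (x + t) ∷ l)
                  (trans (filter-++ _ passed after) (cong (_++ runner s after) (runner-none passed passed-otherRunners))) ⟩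
        runner s before ++ (x + t) ∷ runner s after           ∎

      runner-source : runner s (beta ν N) ≡ runner s before ++ x ∷ runner s after
      runner-source = begin
        runner s (beta ν N)                                   ≡⟨ cong (runner s) source ⟩
        runner s (before ++ passed ++ x ∷ after)              ≡⟨ filter-++ _ before _ ⟩
        runner s before ++ runner s (passed ++ x ∷ after)
          ≡⟨ cong (runner s before ++_)
                  (trans (filter-++ _ passed (x ∷ after)) (cong (_++ runner s (x ∷ after)) (runner-none passed passed-otherRunners))) ⟩
        runner s before ++ runner s (x ∷ after)               ≡⟨ cong (runner s before ++_) (runner-accept x after refl) ⟩
        runner s before ++ x ∷ runner s after                 ∎

      runnerSize-moved : runnerSize κ N s ≡ suc (runnerSize ν N s)
      runnerSize-moved = begin
        size (quotParts (map (divt t) (runner s (beta κ N))))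
          ≡⟨ cong (λ l → size (quotParts (map (divt t) l))) runner-moved ⟩
        size (quotParts (map (divt t) (runner s before ++ (x + t) ∷ runner s after)))
          ≡⟨ cong (size ∘ quotParts) (trans (map-++ (divt t) (runner s before) _)
               (cong (λ y → map (divt t) (runner s before) ++ y ∷ map (divt t) (runner s after)) (/-+t x))) ⟩
        size (quotParts (map (divt t) (runner s before) ++ suc (x / t) ∷ map (divt t) (runner s after)))
          ≡⟨ size-quotParts-bump (map (divt t) (runner s before)) (x / t) (map (divt t) (runner s after))
               (subst (_≤ x / t) (sym (length-map (divt t) (runner s after))) (length-runner-below x after below-decreasing)) ⟩
        suc (size (quotParts (map (divt t) (runner s before) ++ x / t ∷ map (divt t) (runner s after))))
          ≡⟨ cong (suc ∘ size ∘ quotParts) (map-++ (divt t) (runner s before) _) ⟨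
        suc (size (quotParts (map (divt t) (runner s before ++ x ∷ runner s after))))
          ≡⟨ cong (λ l → suc (size (quotParts (map (divt t) l)))) runner-source ⟨
        suc (size (quotParts (map (divt t) (runner s (beta ν N))))) ∎

    quotientSizeAt-move : quotientSizeAt κ N ≡ suc (quotientSizeAt ν N)
    quotientSizeAt-move = begin
      sum (map (runnerSize κ N) (upTo t))         ≡⟨ cong sum (map-upTo (runnerSize κ N) t) ⟩
      sum (applyUpTo (runnerSize κ N) t)          ≡⟨ sum-applyUpTo-bump t (m%n<n x t) runnerSize-other runnerSize-moved ⟩
      suc (sum (applyUpTo (runnerSize ν N) t))    ≡⟨ cong (suc ∘ sum) (map-upTo (runnerSize ν N) t) ⟨
      suc (sum (map (runnerSize ν N) (upTo t)))   ∎

    residuePairs-move : parity (residuePairs κ N) ≡ parity (residuePairs ν N + length passed)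
    residuePairs-move = begin
      parity (increasingPairs (map (modt t) (beta κ N)))
        ≡⟨ cong (λ l → parity (increasingPairs (map (modt t) l))) target ⟩
      parity (increasingPairs (map (modt t) (before ++ (x + t) ∷ passed ++ after)))
        ≡⟨ cong (parity ∘ increasingPairs) (trans (map-++ (modt t) before _)
             (cong (map (modt t) before ++_) (cong₂ _∷_ (%-+t x) (map-++ (modt t) passed after)))) ⟩
      parity (increasingPairs (map (modt t) before ++ s ∷ map (modt t) passed ++ map (modt t) after))
        ≡⟨ parity-increasingPairs-move (map (modt t) before) s (map (modt t) passed) (map (modt t) after) (All-map⁺ passed-otherRunners) ⟩
      parity (increasingPairs (map (modt t) before ++ map (modt t) passed ++ s ∷ map (modt t) after) + length (map (modt t) passed))
        ≡⟨ cong₂ (λ l n → parity (increasingPairs l + n))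
                 (sym (trans (map-++ (modt t) before _) (cong (map (modt t) before ++_) (map-++ (modt t) passed (x ∷ after)))))
                 (length-map (modt t) passed) ⟩
      parity (increasingPairs (map (modt t) (before ++ passed ++ x ∷ after)) + length passed)
        ≡⟨ cong (λ l → parity (increasingPairs (map (modt t) l) + length passed)) source ⟨
      parity (increasingPairs (map (modt t) (beta ν N)) + length passed) ∎

  private
    applyUpTo≡downFrom : ∀ m → applyUpTo (λ i → m ∸ suc i) m ≡ downFrom m
    applyUpTo≡downFrom zero    = refl
    applyUpTo≡downFrom (suc m) = cong (m ∷_) (applyUpTo≡downFrom m)

    runner-downFrom-≤ : ∀ {r} m → m ≤ t → m ≤ r → runner r (downFrom m) ≡ []
    runner-downFrom-≤ zero    _   _   = refl
    runner-downFrom-≤ (suc m) m<t m<r =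
      trans (runner-reject m (downFrom m) (<⇒≢ m<r ∘ trans (sym (m<n⇒m%n≡m m<t))))
            (runner-downFrom-≤ m (<⇒≤ m<t) (<⇒≤ m<r))

    runner-downFrom : ∀ {r} m → m ≤ t → r < m → runner r (downFrom m) ≡ [ r ]
    runner-downFrom {r} (suc m) m<t r<m with m ≟ r
    ... | yes refl = trans (runner-accept m (downFrom m) (m<n⇒m%n≡m m<t)) (cong (m ∷_) (runner-downFrom-≤ m (<⇒≤ m<t) ≤-refl))
    ... | no m≢r   = trans (runner-reject m (downFrom m) (m≢r ∘ trans (sym (m<n⇒m%n≡m m<t))))
                           (runner-downFrom m (<⇒≤ m<t) (≤∧≢⇒< (s≤s⁻¹ r<m) (m≢r ∘ sym)))

    beta-+t : ∀ L N → length L ≤ N → beta L (N + t) ≡ map (_+ t) (beta L N) ++ downFrom t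
    beta-+t L N L≤N = begin
      beta L (N + t)                                                   ≡⟨ beta≡applyUpTo L (N + t) ⟩
      applyUpTo (bead L (N + t)) (N + t)                               ≡⟨ applyUpTo-+ (bead L (N + t)) N t ⟩
      applyUpTo (bead L (N + t)) N ++ applyUpTo (λ i → bead L (N + t) (N + i)) t ≡⟨ cong₂ _++_ upper lower ⟩
      map (_+ t) (beta L N) ++ downFrom t                             ∎
      where
      upper : applyUpTo (bead L (N + t)) N ≡ map (_+ t) (beta L N)
      upper = begin
        applyUpTo (bead L (N + t)) N
          ≡⟨ applyUpTo-cong N (λ i i<N → trans (cong (part L i +_) (+-∸-comm t i<N)) (sym (+-assoc (part L i) _ t))) ⟩
        applyUpTo ((_+ t) ∘ bead L N) N          ≡⟨ map-applyUpTo (bead L N) (_+ t) N ⟨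
        map (_+ t) (applyUpTo (bead L N) N)      ≡⟨ cong (map (_+ t)) (beta≡applyUpTo L N) ⟨
        map (_+ t) (beta L N)                    ∎
      lower : applyUpTo (λ i → bead L (N + t) (N + i)) t ≡ downFrom t
      lower = trans (applyUpTo-cong t (λ i _ → cong₂ _+_ (part-≥length L (≤-trans L≤N (m≤m+n N i)))
                                                          (trans (cong (N + t ∸_) (sym (+-suc N i))) ([m+n]∸[m+o]≡n∸o N t (suc i)))))
                    (applyUpTo≡downFrom t)

    runnerSize-+t : ∀ L N → length L ≤ N → ∀ r → r < t → runnerSize L (N + t) r ≡ runnerSize L N r
    runnerSize-+t L N L≤N r r<t = begin
      size (quotParts (map (divt t) (runner r (beta L (N + t)))))
        ≡⟨ cong (λ l → size (quotParts (map (divt t) (runner r l)))) (beta-+t L N L≤N) ⟩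
      size (quotParts (map (divt t) (runner r (map (_+ t) (beta L N) ++ downFrom t))))
        ≡⟨ cong (λ l → size (quotParts (map (divt t) l)))
                (trans (filter-++ _ (map (_+ t) (beta L N)) (downFrom t)) (cong₂ _++_ (runner-+t r (beta L N)) (runner-downFrom t ≤-refl r<t))) ⟩
      size (quotParts (map (divt t) (map (_+ t) (runner r (beta L N)) ++ [ r ])))
        ≡⟨ cong (size ∘ quotParts) (trans (map-++ (divt t) (map (_+ t) (runner r (beta L N))) [ r ])
                                          (cong₂ _++_ (divt-+t (runner r (beta L N))) (cong [_] (m<n⇒m/n≡0 r<t)))) ⟩
      size (quotParts (map suc (map (divt t) (runner r (beta L N))) ++ [ 0 ]))
        ≡⟨ size-quotParts-pad (map (divt t) (runner r (beta L N))) ⟩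
      size (quotParts (map (divt t) (runner r (beta L N))))  ∎
      where
      divt-+t : ∀ X → map (divt t) (map (_+ t) X) ≡ map suc (map (divt t) X)
      divt-+t []      = refl
      divt-+t (y ∷ X) = cong₂ _∷_ (/-+t y) (divt-+t X)

    quotientSizeAt-+t : ∀ L N → length L ≤ N → quotientSizeAt L (N + t) ≡ quotientSizeAt L N
    quotientSizeAt-+t L N L≤N = begin
      sum (map (runnerSize L (N + t)) (upTo t))   ≡⟨ cong sum (map-upTo (runnerSize L (N + t)) t) ⟩
      sum (applyUpTo (runnerSize L (N + t)) t)    ≡⟨ cong sum (applyUpTo-cong t (runnerSize-+t L N L≤N)) ⟩
      sum (applyUpTo (runnerSize L N) t)          ≡⟨ cong sum (map-upTo (runnerSize L N) t) ⟨
      sum (map (runnerSize L N) (upTo t))         ∎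

  quotientSizeAt≡quotientSize : ∀ L M → length L ≤ M → quotientSizeAt L (t * M) ≡ quotientSize t L
  quotientSizeAt≡quotientSize L M L≤M with m≤n⇒∃[o]m+o≡n L≤M
  ... | j , refl = go j
    where
    go : ∀ j → quotientSizeAt L (t * (length L + j)) ≡ quotientSizeAt L (t * length L)
    go zero    = cong (λ n → quotientSizeAt L (t * n)) (+-identityʳ (length L))
    go (suc j) = begin
      quotientSizeAt L (t * (length L + suc j))   ≡⟨ cong (quotientSizeAt L) N≡ ⟩
      quotientSizeAt L (t * (length L + j) + t)   ≡⟨ quotientSizeAt-+t L _ (≤-trans (m≤m+n (length L) j) (m≤n*m (length L + j) t)) ⟩
      quotientSizeAt L (t * (length L + j))       ≡⟨ go j ⟩
      quotientSizeAt L (t * length L)             ∎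
      where
      N≡ : t * (length L + suc j) ≡ t * (length L + j) + t
      N≡ = trans (cong (t *_) (+-suc (length L) j)) (trans (*-suc t (length L + j)) (+-comm t _))

-- Tilings

module RibbonStep (k : ℕ) {κ ν : Partition} (ribbon : IsRibbon (suc k) κ ν) where
  open Abacus k

  private
    B : BorderStrip κ ν
    B = ribbon⇒borderStrip ribbon
    open BorderStrip B

    size-∸≡t : size κ ∸ size ν ≡ t
    size-∸≡t = proj₂ (proj₂ (proj₂ (proj₂ (proj₂ ribbon))))

    row : ∃ λ i → part ν i < part κ i
    row = nonemptyRow-exists {κ} {ν} inner ν⊆κ (subst (0 <_) (sym size-∸≡t) z<s)

    s₀ : InSkew κ ν (proj₁ row , part ν (proj₁ row))
    s₀ = ≤-refl , proj₂ row

    open StripRows B s₀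
    open ConjugateRows B s₀

    module M  = StripMove B s₀ t (subst (λ n → n + part ν b ≡ part κ a + (b ∸ a)) size-∸≡t size-∸)
    module M′ = StripMove (borderStrip-conj B) s₀′ t
      (subst (λ n → n + part (conj ν) R′.b ≡ part (conj κ) R′.a + (R′.b ∸ R′.a)) size-∸≡t size-∸-conj)

  heights : ht κ ν + ht (conj κ) (conj ν) ≡ k
  heights = suc-injective (trans (sym size-∸≡suc[ht+ht′]) size-∸≡t)

  residuePairs-step : ∀ N → length κ ≤ N → parity (residuePairs κ N) ≡ parity (residuePairs ν N + ht κ ν)
  residuePairs-step N κ≤N =
    trans (residuePairs-move {N} {ν} {κ} (M.beadMove N κ≤N))
          (cong (λ n → parity (residuePairs ν N + n)) (M.length-passed N κ≤N))

  residuePairs-conj-step : ∀ N → length (conj κ) ≤ N →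
    parity (residuePairs (conj κ) N) ≡ parity (residuePairs (conj ν) N + ht (conj κ) (conj ν))
  residuePairs-conj-step N κ′≤N =
    trans (residuePairs-move {N} {conj ν} {conj κ} (M′.beadMove N κ′≤N))
          (cong (λ n → parity (residuePairs (conj ν) N + n)) (M′.length-passed N κ′≤N))

  quotientSize-step : quotientSize t κ ≡ suc (quotientSize t ν)
  quotientSize-step = begin
    quotientSizeAt κ (t * length κ)         ≡⟨ quotientSizeAt-move {t * length κ} {ν} {κ} (M.beadMove (t * length κ) (m≤n*m (length κ) t)) ⟩
    suc (quotientSizeAt ν (t * length κ))   ≡⟨ cong suc (quotientSizeAt≡quotientSize ν (length κ) (length-mono {κ} inner ν⊆κ)) ⟩
    suc (quotientSize t ν)                  ∎

module _ (k : ℕ) where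
  open Abacus k

  tiling-residuePairs : ∀ {μ λ′ h} N → Tiling t μ λ′ h → length λ′ ≤ N →
    parity (residuePairs λ′ N) ≡ parity (residuePairs μ N + h)
  tiling-residuePairs {μ} N done _ = cong parity (sym (+-identityʳ (residuePairs μ N)))
  tiling-residuePairs {μ} N (add {ν} {κ} {h} T ribbon) κ≤N = begin
    parity (residuePairs κ N)                     ≡⟨ RibbonStep.residuePairs-step k ribbon N κ≤N ⟩
    parity (residuePairs ν N + ht κ ν)
      ≡⟨ parity-+-cong {residuePairs ν N} {residuePairs μ N + h} {ht κ ν} (tiling-residuePairs N T ν≤N) refl ⟩
    parity (residuePairs μ N + h + ht κ ν)        ≡⟨ cong parity (+-assoc (residuePairs μ N) h (ht κ ν)) ⟩
    parity (residuePairs μ N + (h + ht κ ν))      ∎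
    where
    ν≤N : length ν ≤ N
    ν≤N = ≤-trans (length-mono {κ} (proj₁ ribbon) (ribbon-⊆ₚ ribbon)) κ≤N

  tiling-quotient-conj : ∀ {μ λ′ h} N N′ → Tiling t μ λ′ h → length λ′ ≤ N → part λ′ 0 ≤ N′ →
    ∃ λ j → quotientSize t λ′ ≡ quotientSize t μ + j
          × parity (residuePairs λ′ N + residuePairs (conj λ′) N′) ≡ parity (residuePairs μ N + residuePairs (conj μ) N′ + j * k)
  tiling-quotient-conj {μ} N N′ done _ _ =
    0 , sym (+-identityʳ (quotientSize t μ)) , cong parity (sym (+-identityʳ (residuePairs μ N + residuePairs (conj μ) N′)))
  tiling-quotient-conj {μ} N N′ (add {ν} {κ} T ribbon) κ≤N κ₀≤N′
    with tiling-quotient-conj N N′ T (≤-trans (length-mono {κ} (proj₁ ribbon) (ribbon-⊆ₚ ribbon)) κ≤N)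
                                     (≤-trans (ribbon-⊆ₚ ribbon 0) κ₀≤N′)
  ... | j , q≡ , p≡ = suc j , q≡′ , p≡′
    where
    open RibbonStep k ribbon
    Pμ : ℕ
    Pμ = residuePairs μ N + residuePairs (conj μ) N′
    q≡′ : quotientSize t κ ≡ quotientSize t μ + suc j
    q≡′ = trans quotientSize-step (trans (cong suc q≡) (sym (+-suc _ j)))
    p≡′ : parity (residuePairs κ N + residuePairs (conj κ) N′) ≡ parity (Pμ + suc j * k)
    p≡′ = begin
      parity (residuePairs κ N + residuePairs (conj κ) N′)
        ≡⟨ parity-+-cong {residuePairs κ N} {residuePairs ν N + ht κ ν} {residuePairs (conj κ) N′}
                         (residuePairs-step N κ≤N) (residuePairs-conj-step N′ (subst (_≤ N′) (sym (length-conj κ)) κ₀≤N′)) ⟩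
      parity ((residuePairs ν N + ht κ ν) + (residuePairs (conj ν) N′ + ht (conj κ) (conj ν)))
        ≡⟨ cong parity (+-interchange (residuePairs ν N) _ _ _) ⟩
      parity ((residuePairs ν N + residuePairs (conj ν) N′) + (ht κ ν + ht (conj κ) (conj ν)))
        ≡⟨ parity-+-cong {residuePairs ν N + residuePairs (conj ν) N′} {Pμ + j * k} {ht κ ν + ht (conj κ) (conj ν)} p≡ (cong parity heights) ⟩
      parity (Pμ + j * k + k)
        ≡⟨ cong parity (trans (+-assoc Pμ (j * k) k) (cong (Pμ +_) (+-comm (j * k) k))) ⟩
      parity (Pμ + suc j * k) ∎

  tilings-heights : ∀ {μ λ′ h h′} → Tiling t μ λ′ h → Tiling t (conj μ) (conj λ′) h′ →
    ∃ λ j → quotientSize t λ′ ≡ quotientSize t μ + j × parity (h + h′) ≡ parity (k * j)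
  tilings-heights {μ} {λ′} {h} {h′} T T′
    with tiling-quotient-conj (length λ′) (length (conj λ′)) T ≤-refl (≤-reflexive (sym (length-conj λ′)))
  ... | j , q≡ , p≡ = j , q≡ , trans (parity-cancelˡ Pμ same) (cong parity (*-comm j k))
    where
    N N′ Pμ : ℕ
    N = length λ′
    N′ = length (conj λ′)
    Pμ = residuePairs μ N + residuePairs (conj μ) N′
    same : parity (Pμ + (h + h′)) ≡ parity (Pμ + j * k)
    same = begin
      parity (Pμ + (h + h′))
        ≡⟨ cong parity (+-interchange (residuePairs μ N) h (residuePairs (conj μ) N′) h′) ⟨
      parity ((residuePairs μ N + h) + (residuePairs (conj μ) N′ + h′))
        ≡⟨ parity-+-cong {residuePairs λ′ N} {residuePairs μ N + h} {residuePairs (conj λ′) N′}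
                         (tiling-residuePairs N T ≤-refl) (tiling-residuePairs N′ T′ ≤-refl) ⟨
      parity (residuePairs λ′ N + residuePairs (conj λ′) N′)
        ≡⟨ p≡ ⟩
      parity (Pμ + j * k) ∎

lemma4p6 : (t : ℕ) → 2 ≤ t → (λ′ μ : Partition) → IsPartition λ′ → IsPartition μ
    → μ ⊆ₚ λ′ → Tileable t λ′ μ
    → ∀ {h h′} → Tiling t μ λ′ h → Tiling t (conj μ) (conj λ′) h′
    → negOnePow h ℤ.* negOnePow h′
      ≡ negOnePowℤ (ℤ.+ (t ∸ 1) ℤ.* (ℤ.+ quotientSize t λ′ ℤ.- ℤ.+ quotientSize t μ))
-- Only the two tilings are used; in particular the argument also covers t = 1.
lemma4p6 (suc k) _ λ′ μ _ _ _ _ {h} {h′} T T′ with tilings-heights k T T′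
... | j , q≡ , h+h′≡k*j = begin
  negOnePow h ℤ.* negOnePow h′   ≡⟨ negOnePow-+ h h′ ⟨
  negOnePow (h + h′)             ≡⟨ negOnePow-parity {h + h′} {k * j} h+h′≡k*j ⟩
  negOnePowℤ (ℤ.+ (k * j))       ≡⟨ cong negOnePowℤ (ℤ.pos-* k j) ⟩
  negOnePowℤ (ℤ.+ k ℤ.* ℤ.+ j)   ≡⟨ cong (λ z → negOnePowℤ (ℤ.+ k ℤ.* z)) (+[m+n]-+m≡+n (quotientSize (suc k) μ) j) ⟨
  negOnePowℤ (ℤ.+ k ℤ.* (ℤ.+ (quotientSize (suc k) μ + j) ℤ.- ℤ.+ quotientSize (suc k) μ))
                                 ≡⟨ cong (λ q → negOnePowℤ (ℤ.+ k ℤ.* (ℤ.+ q ℤ.- ℤ.+ quotientSize (suc k) μ))) q≡ ⟨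
  negOnePowℤ (ℤ.+ k ℤ.* (ℤ.+ quotientSize (suc k) λ′ ℤ.- ℤ.+ quotientSize (suc k) μ)) ∎
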